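{- Let $\mathfrak{g}$ be of type $A_n$ with $I=\{1,\dots,n\}$ and $\mathbf{c}$ given by $c_{ij}=0$ if $i>j$, $c_{ij}=1$ if $i<j$. The map $$\prod_{1\le j\le k\le n}\Big(\prod_{p=j}^{k}A_{p,k-p}^{ -1}\Big)^{\ell_{j,k}}\ \longmapsto\ \sum_{j=1}^{n}\sum_{k=j}^{n}\ell_{j,k}(\alpha_{j,k})$$ (well defined since every $M\in\mathcal{M}(\infty)_{\mathbf{c}}$ has a unique such expression with $\ell_{j,k}\in\mathbb{Z}_{\ge0}$) is a $U_q(A_n)$-crystal isomorphism from $\mathcal{M}(\infty)_{\mathbf{c}}$ to the crystal $\mathrm{Kp}(\infty)$ of Kostant partitions.
   Context: Modified Nakajima monomials: for $M=\prod_{i,k}Y_{i,k}^{y_i(k)}$ in commuting variables $Y_{i,k}$, $\mathrm{wt}(M)=\sum_i(\sum_k y_i(k))\Lambda_i$, $\varphi_i(M)=\max\{\sum_{j\le k}y_i(j)\colon k\in\mathbb{Z}\}$, $\varepsilon_i(M)=\varphi_i(M)-\langle h_i,\mathrm{wt}(M)\rangle$, $f_iM=MA^{ -1}_{i,\overline{k}}$ with $\overline{k}=\min\{k\ge0\colon\varphi_i(M)=\sum_{0\le j\le k}y_i(j)\}$, $e_iM=MA_{i,k^e}$ if $\varepsilon_i(M)>0$ (else $0$) with $k^e=\max\{k\colon\varphi_i(M)=\sum_{j\le k}y_i(j)\}$; here $A_{i,k}=Y_{i,k}Y_{i,k+1}\prod_{j\ne i}Y_{j,k+c_{ji}}^{C_{ji}}$,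 which in type $A_n$ with this $\mathbf{c}$ is $Y_{i,k}Y_{i,k+1}Y_{i-1,k+1}^{ -1}Y_{i+1,k}^{ -1}$ (with $Y_{0,\cdot}=Y_{n+1,\cdot}=1$). $\mathcal{M}(\infty)_{\mathbf{c}}$ is the closure of $\mathbf{1}$ under these operators. Kostant partitions: positive roots $\alpha_{j,k}=\alpha_j+\dots+\alpha_k$ ($1\le j\le k\le n$); $\mathrm{Kp}(\infty)$ is the set of formal sums $\boldsymbol{\alpha}=\sum c_{\alpha}(\alpha)$ over positive roots with $c_\alpha\in\mathbb{Z}_{\ge0}$. For $i\in I$, $S_i(\boldsymbol\alpha)$ is the bracket string consisting, from left to right, of $c_{\alpha_{i,n}}$ copies of ')', $c_{\alpha_{i+1,n}}$ copies of '(', $c_{\alpha_{i,n-1}}$ of ')', $c_{\alpha_{i+1,n-1}}$ of '(', ..., $c_{\alpha_{i,i+1}}$ of ')', $c_{\alpha_{i+1,i+1}}$ of '(', $c_{\alpha_{i,i}}$ of ')'; successively cancel '()' pairs leaving $)\cdots)(\cdots($. Then: $e_i\boldsymbol\alpha=\boldsymbol\alpha-(\beta)+(\beta-\alpha_i)$ where $\beta$ is the root of the rightmost uncanceled ')' (with $(0)$ read as zero; $e_i\boldsymbol\alpha$ undefined/0 if none); $f_i\boldsymbol\alpha=\boldsymbol\alpha-(\gamma)+(\gamma+\alpha_i)$ where $\gamma$ is the root of the leftmost uncanceled '(', or $f_i\boldsymbol\alpha=\boldsymbol\alpha+(\alpha_i)$ if none; $\mathrm{wt}(\boldsymbol\alpha)=-\sum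 c_\alpha\alpha$; $\varepsilon_i(\boldsymbol\alpha)$ is the number of uncanceled ')'; $\varphi_i=\varepsilon_i+\langle h_i,\mathrm{wt}\rangle$. -}

module Defs where

-- Type A_n, I = {1,…,n}; we index I by 0,…,n-1 (ℕ value i stands for i+1).
-- Weights are recorded by their coordinates in the fundamental weights Λ_i,
-- i.e. as functions Fin n → ℤ  (coordinate i = ⟨h_i , wt⟩).

open import Data.Nat as ℕ using (ℕ; zero; suc; _≤_; _<_; _≤?_; _<?_; _∸_)
open import Data.Integer as ℤ using (ℤ; +_; -_; _⊔_)
open import Data.Integer.Properties as ℤP using ()
open import Data.Fin using (Fin; toℕ)
open import Data.List using (List; []; _∷_; _++_; replicate; length; foldr; upTo; downFrom; map; concatMap; filter; last)
open import Data.Maybe using (Maybe; just; nothing)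
open import Data.Bool using (Bool; true; false; if_then_else_; _∧_)
open import Data.Product using (_×_; _,_; proj₁; proj₂)
open import Relation.Nullary using (does; yes; no)
open import Relation.Binary.PropositionalEquality using (_≡_)

-- Laurent monomials in the Y_{i,k}  (i ∈ I, k ∈ ℤ≥0)
-- A monomial M is given, for each i, by the finite list of exponents
-- y_i(0), y_i(1), … (missing entries are 0).

Mon : ℕ → Set
Mon n = Fin n → List ℤ

at : List ℤ → ℕ → ℤ
at []       _       = + 0
at (x ∷ xs) zero    = x
at (x ∷ xs) (suc k) = at xs k

y : ∀ {n} → Mon n → Fin n → ℕ → ℤ
y M i k = at (M i) k

_≈M_ : ∀ {n} → Mon n → Mon n → Set
M ≈M N = ∀ i k → y M i k ≡ y N i k

addL : List ℤ → List ℤ → List ℤ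
addL []       ys       = ys
addL xs       []       = xs
addL (x ∷ xs) (z ∷ zs) = (x ℤ.+ z) ∷ addL xs zs

_·_ : ∀ {n} → Mon n → Mon n → Mon n
(M · N) i = addL (M i) (N i)

𝟏 : ∀ {n} → Mon n
𝟏 _ = []

place : ℕ → List ℤ → List ℤ
place k xs = replicate k (+ 0) ++ xs

-- A_{i,k} = Y_{i,k} Y_{i,k+1} Y_{i-1,k+1}^{-1} Y_{i+1,k}^{-1}   (type A_n, this c)
-- (i is the 0-based index of the node; missing neighbours give factor 1)
A : ∀ {n} → ℕ → ℕ → Mon n
A i k j =
  if does (toℕ j ℕ.≟ i) then place k (+ 1 ∷ + 1 ∷ [])
  else if does (suc (toℕ j) ℕ.≟ i) then place (suc k) (- (+ 1) ∷ [])
  else if does (toℕ j ℕ.≟ suc i) then place k (- (+ 1) ∷ [])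
  else []

A⁻¹ : ∀ {n} → ℕ → ℕ → Mon n
A⁻¹ i k j = map -_ (A i k j)

pow : ∀ {n} → Mon n → ℕ → Mon n
pow M zero    = 𝟏
pow M (suc m) = M · pow M m

psum : List ℤ → ℕ → ℤ
psum xs zero    = at xs 0
psum xs (suc k) = psum xs k ℤ.+ at xs (suc k)

total : List ℤ → ℤ
total = foldr ℤ._+_ (+ 0)

wtM : ∀ {n} → Mon n → Fin n → ℤ
wtM M i = total (M i)

-- candidate k's: 0 … length; beyond the length of the list the partial sums
-- are constant (= total), so all maxima / extremal k's are found here.
range : List ℤ → List ℕ
range xs = upTo (suc (length xs))

φM : ∀ {n} → Mon n → Fin n → ℤ
φM M i = foldr (λ k acc → psum (M i) k ⊔ acc) (psum (M i) 0) (range (M i))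

εM : ∀ {n} → Mon n → Fin n → ℤ
εM M i = φM M i ℤ.- wtM M i

attains : ∀ {n} → Mon n → Fin n → ℕ → Bool
attains M i k = does (psum (M i) k ℤP.≟ φM M i)

firstTrue : (ℕ → Bool) → List ℕ → ℕ
firstTrue p []       = 0
firstTrue p (k ∷ ks) = if p k then k else firstTrue p ks

kbar : ∀ {n} → Mon n → Fin n → ℕ
kbar M i = firstTrue (attains M i) (range (M i))

-- k^e = max { k : φ_i(M) = Σ_{j≤k} y_i(j) }   (finite when ε_i(M) > 0)
kE : ∀ {n} → Mon n → Fin n → ℕ
kE M i = firstTrue (attains M i) (downFrom (suc (length (M i))))

fM : ∀ {n} → Fin n → Mon n → Mon n
fM i M = M · A⁻¹ (toℕ i) (kbar M i)

eM : ∀ {n} → Fin n → Mon n → Maybe (Mon n)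
eM i M = if does (+ 0 ℤP.<? εM M i) then just (M · A (toℕ i) (kE M i)) else nothing

data InM∞ {n : ℕ} : Mon n → Set where
  one  : InM∞ 𝟏
  byF  : ∀ i M → InM∞ M → InM∞ (fM i M)
  byE  : ∀ i M M' → InM∞ M → eM i M ≡ just M' → InM∞ M'
  resp : ∀ M N → M ≈M N → InM∞ M → InM∞ N

-- Kostant partitions.  Positive root α_{j,k} (0-based: j ≤ k < n).

record PosRoot (n : ℕ) : Set where
  constructor root
  field
    j   : ℕ
    k   : ℕ
    j≤k : j ≤ k
    k<n : k < n

-- a Kostant partition Σ c_α (α) is the multiplicity function α ↦ c_α
Kp : ℕ → Set
Kp n = PosRoot n → ℕ

_≈K_ : ∀ {n} → Kp n → Kp n → Set
c ≈K c' = ∀ r → c r ≡ c' r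

cnt : ∀ {n} → Kp n → ℕ → ℕ → ℕ
cnt {n} c j k with j ≤? k | k <? n
... | yes p | yes q = c (root j k p q)
... | _     | _     = 0

sameRoot : ∀ {n} → ℕ → ℕ → PosRoot n → Bool
sameRoot j k r = does (PosRoot.j r ℕ.≟ j) ∧ does (PosRoot.k r ℕ.≟ k)

addR : ∀ {n} → ℕ → ℕ → Kp n → Kp n
addR j k c r = if sameRoot j k r then suc (c r) else c r

subR : ∀ {n} → ℕ → ℕ → Kp n → Kp n
subR j k c r = if sameRoot j k r then c r ∸ 1 else c r

-- bracket tokens: cl m stands for ')' of root α_{i,m}, op m for '(' of α_{i+1,m}
data Tok : Set where
  cl : ℕ → Tok
  op : ℕ → Tok

string : ∀ {n} → ℕ → Kp n → List Tok
string {n} i c =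
  concatMap (λ m → replicate (cnt c i m) (cl m) ++ replicate (cnt c (suc i) m) (op m))
            (filter (λ m → i <? m) (downFrom n))
  ++ replicate (cnt c i i) (cl i)

-- cancel '()' pairs: returns (uncanceled ')' from right to left ,
--                             uncanceled '(' from right to left)
scan : List Tok → List ℕ → List ℕ → List ℕ × List ℕ
scan []            cs os       = cs , os
scan (cl m ∷ ts)   cs (o ∷ os) = scan ts cs os
scan (cl m ∷ ts)   cs []       = scan ts (m ∷ cs) []
scan (op m ∷ ts)   cs os       = scan ts cs (m ∷ os)

reduced : ∀ {n} → Fin n → Kp n → List ℕ × List ℕ
reduced i c = scan (string (toℕ i) c) [] []

εK : ∀ {n} → Kp n → Fin n → ℕ
εK c i = length (proj₁ (reduced i c))

eK : ∀ {n} → Fin n → Kp n → Maybe (Kp n)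
eK i c with proj₁ (reduced i c)
... | []    = nothing
... | m ∷ _ = just (if does (toℕ i <? m)
                      then addR (suc (toℕ i)) m (subR (toℕ i) m c)   -- β - α_i = α_{i+1,m}
                      else subR (toℕ i) m c)                          -- β = α_i, β - α_i = 0

fK : ∀ {n} → Fin n → Kp n → Kp n
fK i c with last (proj₂ (reduced i c))
... | nothing = addR (toℕ i) (toℕ i) c
... | just m  = addR (toℕ i) m (subR (suc (toℕ i)) m c)

allPairs : ℕ → List (ℕ × ℕ)
allPairs n = concatMap (λ k → map (λ j → j , k) (upTo (suc k))) (upTo n)

cartan : ℕ → ℕ → ℤ
cartan i p = if does (i ℕ.≟ p) then + 2
             else if does (suc i ℕ.≟ p) then - (+ 1)
             else if does (i ℕ.≟ suc p) then - (+ 1)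
             else + 0

pairing : ℕ → ℕ → ℕ → ℤ
pairing i j k = foldr (λ d acc → cartan i (j ℕ.+ d) ℤ.+ acc) (+ 0) (upTo (suc (k ∸ j)))

wtK : ∀ {n} → Kp n → Fin n → ℤ
wtK {n} c i = - foldr (λ jk acc → (+ cnt c (proj₁ jk) (proj₂ jk)) ℤ.* pairing (toℕ i) (proj₁ jk) (proj₂ jk) ℤ.+ acc)
                      (+ 0) (allPairs n)

φK : ∀ {n} → Kp n → Fin n → ℤ
φK c i = + εK c i ℤ.+ wtK c i

block : ∀ {n} → ℕ → ℕ → Mon n
block j k = foldr (λ d acc → A⁻¹ (j ℕ.+ d) (k ∸ (j ℕ.+ d)) · acc) 𝟏 (upTo (suc (k ∸ j)))

monOf : ∀ {n} → Kp n → Mon n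
monOf {n} ℓ = foldr (λ jk acc → pow (block (proj₁ jk) (proj₂ jk)) (cnt ℓ (proj₁ jk) (proj₂ jk)) · acc)
                    𝟏 (allPairs n)

data MaybeRel {A B : Set} (R : A → B → Set) : Maybe A → Maybe B → Set where
  nothing : MaybeRel R nothing nothing
  just    : ∀ {a b} → R a b → MaybeRel R (just a) (just b)

mapMaybe : {A B : Set} → (A → B) → Maybe A → Maybe B
mapMaybe f nothing  = nothing
mapMaybe f (just a) = just (f a)

-- Away from position 0 the monomial monOf ℓ telescopes: row i carries Y_{i,t+1} to the power
-- ℓ_{i+1,i+1+t} - ℓ_{i,i+t} (rows 0-based), which already makes ℓ ↦ monOf ℓ injective. Consequently
-- the partial sums of row i are, up to a constant, the profile R m = (closing brackets of S_i(ℓ) in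
-- blocks ≥ m) - (opening brackets in blocks > m). Cancelling brackets from the left keeps track of
-- max R: the uncanceled closing brackets number max R = ε_i, the rightmost one marks the last
-- maximum k^e and the leftmost uncanceled opening bracket the first maximum k̄. Hence wt, ε_i, φ_i
-- agree, and e_i, f_i, which move one root between rows i and i+1, multiply monOf ℓ by exactly
-- A_{i,k^e} and A_{i,k̄}^{-1}. So the image of monOf is closed under e_i, f_i and contains 1,
-- giving 𝓜(∞) ⊆ image; conversely the potential Σ ℓ_{j,k} (n - j) drops under every e_i, the only
-- ℓ with all ε_i = 0 is 0, and f_i e_i = id on monomials, so every monOf ℓ is reached from 1.

module Submission where

open import Defs
open import Data.Nat as ℕ using (ℕ; zero; suc; z≤n; s≤s; _≤_; _<_; _∸_; _≤?_; _<?_)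
import Data.Nat.Properties as ℕₚ
open import Data.Integer as ℤ using (ℤ; +_; -_; _+_; _-_; _*_; _⊔_)
import Data.Integer.Properties as ℤₚ
open import Data.Integer.Tactic.RingSolver using (solve-∀)
open import Data.Fin using (Fin; toℕ; fromℕ<)
import Data.Fin.Properties as Finₚ
open import Data.List using (List; []; _∷_; _++_; [_]; length; foldr; upTo; downFrom; applyUpTo; map; replicate; concatMap; drop; filter; last)
import Data.List.Properties as Listₚ
open import Data.List.Membership.Propositional using (_∈_)
open import Data.List.Membership.Propositional.Properties using (∈-upTo⁺)
open import Data.List.Relation.Unary.Any using (here; there)
open import Data.Maybe using (Maybe; just; nothing)
open import Data.Bool using (Bool; true; false; if_then_else_; _∧_)
import Data.Bool.Properties as Boolₚ
open import Data.Product using (Σ; ∃; _×_; _,_; proj₁; proj₂)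
open import Data.Sum using (_⊎_; inj₁; inj₂)
open import Data.Empty using (⊥-elim)
open import Function using (_∘_)
open import Relation.Nullary using (Dec; yes; no; does; ¬_)
open import Relation.Nullary.Decidable using (dec-true; dec-false)
open import Relation.Unary using (Decidable)
open import Relation.Binary.Definitions using (tri<; tri≈; tri>)
open import Relation.Binary.PropositionalEquality
  using (_≡_; _≢_; refl; sym; trans; cong; cong₂; subst; subst₂; module ≡-Reasoning)

infix 4 _≃_

_≃_ : List ℤ → List ℤ → Set
xs ≃ ys = ∀ t → at xs t ≡ at ys t

at-[] : ∀ t → at [] t ≡ + 0
at-[] zero    = refl
at-[] (suc t) = refl

psum-[] : ∀ k → psum [] k ≡ + 0
psum-[] zero    = refl
psum-[] (suc k) = cong (_+ + 0) (psum-[] k)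

psum-∷ : ∀ x xs k → psum (x ∷ xs) (suc k) ≡ x + psum xs k
psum-∷ x xs zero    = refl
psum-∷ x xs (suc k) = trans (cong (_+ at xs (suc k)) (psum-∷ x xs k)) (ℤₚ.+-assoc x (psum xs k) (at xs (suc k)))

psum-beyond : ∀ xs k → length xs ≤ suc k → psum xs k ≡ total xs
psum-beyond []           k       _        = psum-[] k
psum-beyond (x ∷ [])     zero    _        = sym (ℤₚ.+-identityʳ x)
psum-beyond (x ∷ _ ∷ _)  zero    (s≤s ())
psum-beyond (x ∷ xs)     (suc k) (s≤s le) = trans (psum-∷ x xs k) (cong (λ w → x + w) (psum-beyond xs k le))

psum-cong : ∀ xs ys → xs ≃ ys → ∀ k → psum xs k ≡ psum ys k
psum-cong xs ys e zero    = e 0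
psum-cong xs ys e (suc k) = cong₂ _+_ (psum-cong xs ys e k) (e (suc k))

total-cong : ∀ xs ys → xs ≃ ys → total xs ≡ total ys
total-cong xs ys e = begin
  total xs      ≡⟨ sym (psum-beyond xs K (ℕₚ.m≤n⇒m≤1+n (ℕₚ.m≤m+n _ _))) ⟩
  psum xs K     ≡⟨ psum-cong xs ys e K ⟩
  psum ys K     ≡⟨ psum-beyond ys K (ℕₚ.m≤n⇒m≤1+n (ℕₚ.m≤n+m _ _)) ⟩
  total ys      ∎
  where open ≡-Reasoning
        K = length xs ℕ.+ length ys

at-addL : ∀ xs ys t → at (addL xs ys) t ≡ at xs t + at ys t
at-addL []       ys       t       = sym (trans (cong (_+ at ys t) (at-[] t)) (ℤₚ.+-identityˡ _))
at-addL (x ∷ xs) []       t       = sym (trans (cong (λ w → at (x ∷ xs) t + w) (at-[] t)) (ℤₚ.+-identityʳ _))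
at-addL (x ∷ xs) (z ∷ zs) zero    = refl
at-addL (x ∷ xs) (z ∷ zs) (suc t) = at-addL xs zs t

psum-addL : ∀ xs ys k → psum (addL xs ys) k ≡ psum xs k + psum ys k
psum-addL xs ys zero    = at-addL xs ys 0
psum-addL xs ys (suc k) =
  trans (cong₂ _+_ (psum-addL xs ys k) (at-addL xs ys (suc k)))
        (interchange (psum xs k) (psum ys k) (at xs (suc k)) (at ys (suc k)))
  where interchange : ∀ a b c d → (a + b) + (c + d) ≡ (a + c) + (b + d)
        interchange = solve-∀

total-addL : ∀ xs ys → total (addL xs ys) ≡ total xs + total ys
total-addL []       ys       = sym (ℤₚ.+-identityˡ _)
total-addL (x ∷ xs) []       = sym (ℤₚ.+-identityʳ _)
total-addL (x ∷ xs) (z ∷ zs) = trans (cong (λ w → (x + z) + w) (total-addL xs zs)) (interchange x z (total xs) (total zs))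
  where interchange : ∀ a b c d → (a + b) + (c + d) ≡ (a + c) + (b + d)
        interchange = solve-∀

at-neg : ∀ xs t → at (map -_ xs) t ≡ - at xs t
at-neg []       t       = trans (at-[] t) (cong -_ (sym (at-[] t)))
at-neg (x ∷ xs) zero    = refl
at-neg (x ∷ xs) (suc t) = at-neg xs t

total-neg : ∀ xs → total (map -_ xs) ≡ - total xs
total-neg []       = refl
total-neg (x ∷ xs) = trans (cong (λ w → - x + w) (total-neg xs)) (sym (ℤₚ.neg-distrib-+ x (total xs)))

maxOver : (ℕ → ℤ) → ℤ → List ℕ → ℤ
maxOver f z = foldr (λ k acc → f k ⊔ acc) z

≤-maxOver : ∀ f z {ks k} → k ∈ ks → f k ℤ.≤ maxOver f z ks
≤-maxOver f z {k ∷ ks}  (here refl) = ℤₚ.i≤i⊔j (f k) _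
≤-maxOver f z {k′ ∷ ks} (there k∈) = ℤₚ.≤-trans (≤-maxOver f z k∈) (ℤₚ.i≤j⊔i (f k′) _)

maxOver-attained : ∀ f z ks → maxOver f z ks ≡ z ⊎ ∃ λ k → f k ≡ maxOver f z ks
maxOver-attained f z []       = inj₁ refl
maxOver-attained f z (k ∷ ks) with ℤₚ.⊔-sel (f k) (maxOver f z ks)
... | inj₁ e = inj₂ (k , sym e)
... | inj₂ e with maxOver-attained f z ks
...   | inj₁ e′        = inj₁ (trans e e′)
...   | inj₂ (k′ , e′) = inj₂ (k′ , trans e′ (sym e))

φL : List ℤ → ℤ
φL xs = maxOver (psum xs) (psum xs 0) (range xs)

psum≤φL : ∀ xs k → psum xs k ℤ.≤ φL xs
psum≤φL xs k with k ≤? length xs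
... | yes k≤ = ≤-maxOver (psum xs) (psum xs 0) (∈-upTo⁺ (s≤s k≤))
... | no  k≰ = subst (ℤ._≤ φL xs) (trans (psum-beyond xs (length xs) (ℕₚ.n≤1+n _)) (sym (psum-beyond xs k k≤1+k)))
                 (≤-maxOver (psum xs) (psum xs 0) (∈-upTo⁺ {suc (length xs)} {length xs} ℕₚ.≤-refl))
  where k≤1+k = ℕₚ.m≤n⇒m≤1+n (ℕₚ.<⇒≤ (ℕₚ.≰⇒> k≰))

φL-attained : ∀ xs → ∃ λ k → psum xs k ≡ φL xs
φL-attained xs with maxOver-attained (psum xs) (psum xs 0) (range xs)
... | inj₁ e = 0 , sym e
... | inj₂ a = a

φL-unique : ∀ xs v → (∀ k → psum xs k ℤ.≤ v) → (∃ λ k → psum xs k ≡ v) → φL xs ≡ v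
φL-unique xs v bounded (k , e) with φL-attained xs
... | k′ , e′ = ℤₚ.≤-antisym (subst (ℤ._≤ v) e′ (bounded k′)) (subst (ℤ._≤ φL xs) e (psum≤φL xs k))

φL-cong : ∀ xs ys → xs ≃ ys → φL xs ≡ φL ys
φL-cong xs ys e = φL-unique xs (φL ys)
  (λ k → subst (ℤ._≤ φL ys) (sym (psum-cong xs ys e k)) (psum≤φL ys k))
  (let k , e′ = φL-attained ys in k , trans (psum-cong xs ys e k) e′)

module FirstWitness {P : ℕ → Set} (P? : Decidable P) where

  private
    p : ℕ → Bool
    p k = does (P? k)

  firstTrue-applyUpTo : ∀ f m j → j < m → P (f j) →
    ∃ λ j′ → firstTrue p (applyUpTo f m) ≡ f j′ × P (f j′) × (∀ i → i < j′ → ¬ P (f i))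
  firstTrue-applyUpTo f (suc m) j j<m Pfj with P? (f 0)
  ... | yes Pf0 = 0 , refl , Pf0 , λ _ ()
  ... | no ¬Pf0 with j
  ...   | zero   = ⊥-elim (¬Pf0 Pfj)
  ...   | suc j₁ with firstTrue-applyUpTo (f ∘ suc) m j₁ (ℕₚ.≤-pred j<m) Pfj
  ...     | j′ , e , Pj′ , before = suc j′ , e , Pj′ , λ { zero _ → ¬Pf0 ; (suc i) (s≤s i<j′) → before i i<j′ }

  firstTrue-downFrom : ∀ m j → j < m → P j →
    P (firstTrue p (downFrom m)) × (∀ i → firstTrue p (downFrom m) < i → i < m → ¬ P i)
  firstTrue-downFrom (suc m) j j<m Pj with P? m
  ... | yes Pm = Pm , λ i m<i i<1+m → ⊥-elim (ℕₚ.<-irrefl refl (ℕₚ.<-≤-trans m<i (ℕₚ.≤-pred i<1+m)))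
  ... | no ¬Pm with ℕₚ.m≤n⇒m<n∨m≡n (ℕₚ.≤-pred j<m)
  ...   | inj₂ refl = ⊥-elim (¬Pm Pj)
  ...   | inj₁ j<m′ with firstTrue-downFrom m j j<m′ Pj
  ...     | Pk , after = Pk , after′
    where
      after′ : ∀ i → firstTrue p (downFrom m) < i → i < suc m → ¬ P i
      after′ i k<i i<1+m with ℕₚ.m≤n⇒m<n∨m≡n (ℕₚ.≤-pred i<1+m)
      ... | inj₁ i<m  = after i k<i i<m
      ... | inj₂ refl = ¬Pm

module Argmax (xs : List ℤ) where

  IsMax : ℕ → Set
  IsMax k = psum xs k ≡ φL xs

  open FirstWitness (λ k → psum xs k ℤₚ.≟ φL xs)

  kbarL kEL : ℕ
  kbarL = firstTrue (λ k → does (psum xs k ℤₚ.≟ φL xs)) (range xs)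
  kEL   = firstTrue (λ k → does (psum xs k ℤₚ.≟ φL xs)) (downFrom (suc (length xs)))

  non-max-< : ∀ k → ¬ IsMax k → psum xs k ℤ.< φL xs
  non-max-< k = ℤₚ.≤∧≢⇒< (psum≤φL xs k)

  max-within-length : ∃ λ k → k ≤ length xs × IsMax k
  max-within-length with φL-attained xs
  ... | k , e with k ≤? length xs
  ...   | yes k≤ = k , k≤ , e
  ...   | no  k≰ = length xs , ℕₚ.≤-refl ,
                   trans (psum-beyond xs (length xs) (ℕₚ.n≤1+n _))
                         (trans (sym (psum-beyond xs k (ℕₚ.m≤n⇒m≤1+n (ℕₚ.<⇒≤ (ℕₚ.≰⇒> k≰))))) e)

  kbarL-spec : IsMax kbarL × (∀ j → j < kbarL → psum xs j ℤ.< φL xs)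
  kbarL-spec with max-within-length
  ... | k , k≤ , e with firstTrue-applyUpTo (λ x → x) (suc (length xs)) k (s≤s k≤) e
  ...   | j , refl , Pj , before = Pj , λ i i<j → non-max-< i (before i i<j)

  kEL-spec : total xs ℤ.< φL xs → IsMax kEL × (∀ j → kEL < j → psum xs j ℤ.< φL xs)
  kEL-spec total<φ with max-within-length
  ... | k , k≤ , e with firstTrue-downFrom (suc (length xs)) k (s≤s k≤) e
  ...   | Pk , after = Pk , later
    where
      later : ∀ j → kEL < j → psum xs j ℤ.< φL xs
      later j kE<j with j ≤? length xs
      ... | yes j≤ = non-max-< j (after j kE<j (s≤s j≤))
      ... | no  j≰ = subst (ℤ._< φL xs) (sym (psum-beyond xs j (ℕₚ.m≤n⇒m≤1+n (ℕₚ.<⇒≤ (ℕₚ.≰⇒> j≰))))) total<φ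

  kbarL-unique : ∀ k → IsMax k → (∀ j → j < k → psum xs j ℤ.< φL xs) → kbarL ≡ k
  kbarL-unique k max before with kbarL-spec | ℕₚ.<-cmp kbarL k
  ... | max′ , _       | tri< a _ _ = ⊥-elim (ℤₚ.<-irrefl max′ (before _ a))
  ... | _              | tri≈ _ b _ = b
  ... | _    , before′ | tri> _ _ c = ⊥-elim (ℤₚ.<-irrefl max (before′ _ c))

  kEL-unique : ∀ k → total xs ℤ.< φL xs → IsMax k → (∀ j → k < j → psum xs j ℤ.< φL xs) → kEL ≡ k
  kEL-unique k total<φ max after with kEL-spec total<φ | ℕₚ.<-cmp kEL k
  ... | _    , after′ | tri< a _ _ = ⊥-elim (ℤₚ.<-irrefl max (after′ _ a))
  ... | _             | tri≈ _ b _ = b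
  ... | max′ , _      | tri> _ _ c = ⊥-elim (ℤₚ.<-irrefl max′ (after _ c))

psum-place-< : ∀ k xs t → t < k → psum (place k xs) t ≡ + 0
psum-place-< (suc k) xs zero    _         = refl
psum-place-< (suc k) xs (suc t) (s≤s t<k) = trans (psum-∷ (+ 0) (place k xs) t) (trans (ℤₚ.+-identityˡ _) (psum-place-< k xs t t<k))

psum-place-≡ : ∀ k a b → psum (place k (a ∷ b ∷ [])) k ≡ a
psum-place-≡ zero    a b = refl
psum-place-≡ (suc k) a b = trans (psum-∷ (+ 0) (place k (a ∷ b ∷ [])) k) (trans (ℤₚ.+-identityˡ _) (psum-place-≡ k a b))

psum-place-> : ∀ k a b t → k < t → psum (place k (a ∷ b ∷ [])) t ≡ a + b
psum-place-> zero    a b (suc t) _         =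
  trans (psum-∷ a (b ∷ []) t) (cong (λ z → a + z) (trans (psum-beyond (b ∷ []) t (s≤s z≤n)) (ℤₚ.+-identityʳ b)))
psum-place-> (suc k) a b (suc t) (s≤s k<t) =
  trans (psum-∷ (+ 0) (place k (a ∷ b ∷ [])) t) (trans (ℤₚ.+-identityˡ _) (psum-place-> k a b t k<t))

-- Raising the partial sums by 0 before k = k^e, by 1 at k and by 2 after k: as k is the last
-- maximum, the new maximum φ + 1 is attained first at k.
kbarL-after-bump : ∀ xs ys → total xs ℤ.< φL xs →
  ys ≃ addL xs (place (Argmax.kEL xs) (+ 1 ∷ + 1 ∷ [])) → Argmax.kbarL ys ≡ Argmax.kEL xs
kbarL-after-bump xs ys total<φ ys≃ = Argmax.kbarL-unique ys k (trans at-k (sym φ′≡)) (λ j j<k → subst (psum ys j ℤ.<_) (sym φ′≡) (before-k j j<k))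
  where
    k = Argmax.kEL xs
    spec = Argmax.kEL-spec xs total<φ
    bump = place k (+ 1 ∷ + 1 ∷ [])
    φ = φL xs
    psum-ys : ∀ t → psum ys t ≡ psum xs t + psum bump t
    psum-ys t = trans (psum-cong ys (addL xs bump) ys≃ t) (psum-addL xs bump t)
    at-k : psum ys k ≡ φ + + 1
    at-k = trans (psum-ys k) (cong₂ _+_ (proj₁ spec) (psum-place-≡ k (+ 1) (+ 1)))
    before-k : ∀ j → j < k → psum ys j ℤ.< φ + + 1
    before-k j j<k = subst (ℤ._< φ + + 1) (sym (trans (psum-ys j) (trans (cong (λ z → psum xs j + z) (psum-place-< k bump′ j j<k)) (ℤₚ.+-identityʳ _))))
                           (ℤₚ.≤-<-trans (psum≤φL xs j) (ℤₚ.suc[i]≤j⇒i<j (ℤₚ.≤-reflexive (ℤₚ.+-comm (+ 1) φ))))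
      where bump′ = + 1 ∷ + 1 ∷ []
    after-k : ∀ t → k < t → psum ys t ℤ.≤ φ + + 1
    after-k t k<t = subst (ℤ._≤ φ + + 1) (sym (trans (psum-ys t) (cong (λ z → psum xs t + z) (psum-place-> k (+ 1) (+ 1) t k<t))))
                      (subst (ℤ._≤ φ + + 1) (lemma (psum xs t)) (ℤₚ.+-monoˡ-≤ (+ 1) (ℤₚ.i<j⇒suc[i]≤j (proj₂ spec t k<t))))
      where lemma : ∀ a → + 1 + a + + 1 ≡ a + (+ 1 + + 1)
            lemma = solve-∀
    φ′≡ : φL ys ≡ φ + + 1
    φ′≡ = φL-unique ys (φ + + 1) bounded (k , at-k)
      where
        bounded : ∀ t → psum ys t ℤ.≤ φ + + 1
        bounded t with ℕₚ.<-cmp t k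
        ... | tri< t<k _ _  = ℤₚ.<⇒≤ (before-k t t<k)
        ... | tri≈ _ refl _ = ℤₚ.≤-reflexive at-k
        ... | tri> _ _ k<t  = after-k t k<t

y-· : ∀ {n} (M N : Mon n) i t → y (M · N) i t ≡ y M i t + y N i t
y-· M N i t = at-addL (M i) (N i) t

·-congˡ : ∀ {n} (M N P : Mon n) → M ≈M N → (M · P) ≈M (N · P)
·-congˡ M N P e i t = trans (y-· M P i t) (trans (cong (_+ y P i t) (e i t)) (sym (y-· N P i t)))

y-pow : ∀ {n} (M : Mon n) c i t → y (pow M c) i t ≡ + c * y M i t
y-pow M zero    i t = at-[] t
y-pow M (suc c) i t = trans (y-· M (pow M c) i t) (trans (cong (λ w → y M i t + w) (y-pow M c i t)) (lemma (y M i t) (+ c)))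
  where lemma : ∀ z c′ → z + c′ * z ≡ (+ 1 + c′) * z
        lemma = solve-∀

total-· : ∀ {n} (M N : Mon n) i → total ((M · N) i) ≡ total (M i) + total (N i)
total-· M N i = total-addL (M i) (N i)

total-pow : ∀ {n} (M : Mon n) c i → total (pow M c i) ≡ + c * total (M i)
total-pow M zero    i = refl
total-pow M (suc c) i = trans (total-· M (pow M c) i) (trans (cong (λ w → total (M i) + w) (total-pow M c i)) (lemma (total (M i)) (+ c)))
  where lemma : ∀ z c′ → z + c′ * z ≡ (+ 1 + c′) * z
        lemma = solve-∀

δD : ∀ {P : Set} → Dec P → ℤ
δD d = if does d then + 1 else + 0

δ : ℕ → ℕ → ℤ
δ x y = δD (x ℕ.≟ y)

δ-refl : ∀ x → δ x x ≡ + 1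
δ-refl zero    = refl
δ-refl (suc x) = δ-refl x

δ-≢ : ∀ x y → x ≢ y → δ x y ≡ + 0
δ-≢ x y x≢y = cong (λ b → if b then + 1 else + 0) (dec-false (x ℕ.≟ y) x≢y)

δδ-≢ : ∀ j k a b → (j ≢ a ⊎ k ≢ b) → δ j a * δ k b ≡ + 0
δδ-≢ j k a b (inj₁ j≢a) rewrite δ-≢ j a j≢a = refl
δδ-≢ j k a b (inj₂ k≢b) rewrite δ-≢ k b k≢b = ℤₚ.*-zeroʳ (δ j a)

at-place1 : ∀ m a t → at (place m (a ∷ [])) t ≡ δ t m * a
at-place1 zero    a zero    = sym (ℤₚ.*-identityˡ a)
at-place1 zero    a (suc t) = trans (at-[] t) (sym (ℤₚ.*-zeroˡ a))
at-place1 (suc m) a zero    = sym (ℤₚ.*-zeroˡ a)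
at-place1 (suc m) a (suc t) = at-place1 m a t

at-place2 : ∀ m a b t → at (place m (a ∷ b ∷ [])) t ≡ δ t m * a + δ t (suc m) * b
at-place2 zero    a b zero          = sym (lemma a b)
  where lemma : ∀ a b → + 1 * a + + 0 * b ≡ a
        lemma = solve-∀
at-place2 zero    a b (suc zero)    = sym (lemma a b)
  where lemma : ∀ a b → + 0 * a + + 1 * b ≡ b
        lemma = solve-∀
at-place2 zero    a b (suc (suc t)) = sym (lemma a b)
  where lemma : ∀ a b → + 0 * a + + 0 * b ≡ + 0
        lemma = solve-∀
at-place2 (suc m) a b zero          = sym (lemma a b)
  where lemma : ∀ a b → + 0 * a + + 0 * b ≡ + 0
        lemma = solve-∀
at-place2 (suc m) a b (suc t)       = at-place2 m a b t

total-place : ∀ m xs → total (place m xs) ≡ total xs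
total-place zero    xs = refl
total-place (suc m) xs = trans (ℤₚ.+-identityˡ _) (total-place m xs)

-- Row r of A_{p,m} with the three tests of its definition abstracted, so that they can be case-split.
rowA : ∀ {P Q R : Set} → ℕ → Dec P → Dec Q → Dec R → List ℤ
rowA m d₁ d₂ d₃ =
  if does d₁ then place m (+ 1 ∷ + 1 ∷ [])
  else if does d₂ then place (suc m) (- (+ 1) ∷ [])
  else if does d₃ then place m (- (+ 1) ∷ [])
  else []

expA : ℕ → ℕ → ℕ → ℕ → ℤ
expA r p m t = δ r p * (δ t m + δ t (suc m)) - δ (suc r) p * δ t (suc m) - δ r (suc p) * δ t m

at-rowA : ∀ r p m t (d₁ : Dec (r ≡ p)) (d₂ : Dec (suc r ≡ p)) (d₃ : Dec (r ≡ suc p)) →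
  at (rowA m d₁ d₂ d₃) t ≡ δD d₁ * (δ t m + δ t (suc m)) - δD d₂ * δ t (suc m) - δD d₃ * δ t m
at-rowA r p m t (yes refl) (yes ())  d₃
at-rowA r p m t (yes refl) (no _)    (yes ())
at-rowA r p m t (yes refl) (no _)    (no _)   = trans (at-place2 m (+ 1) (+ 1) t) (lemma (δ t m) (δ t (suc m)))
  where lemma : ∀ a b → a * + 1 + b * + 1 ≡ + 1 * (a + b) - + 0 * b - + 0 * a
        lemma = solve-∀
at-rowA r p m t (no _)     (yes refl) (yes ())
at-rowA r p m t (no _)     (yes _)   (no _)   = trans (at-place1 (suc m) (- (+ 1)) t) (lemma (δ t m) (δ t (suc m)))
  where lemma : ∀ a b → b * - (+ 1) ≡ + 0 * (a + b) - + 1 * b - + 0 * a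
        lemma = solve-∀
at-rowA r p m t (no _)     (no _)    (yes _)  = trans (at-place1 m (- (+ 1)) t) (lemma (δ t m) (δ t (suc m)))
  where lemma : ∀ a b → a * - (+ 1) ≡ + 0 * (a + b) - + 0 * b - + 1 * a
        lemma = solve-∀
at-rowA r p m t (no _)     (no _)    (no _)   = trans (at-[] t) (lemma (δ t m) (δ t (suc m)))
  where lemma : ∀ a b → + 0 ≡ + 0 * (a + b) - + 0 * b - + 0 * a
        lemma = solve-∀

total-rowA : ∀ {P Q R : Set} m (d₁ : Dec P) (d₂ : Dec Q) (d₃ : Dec R) →
  total (rowA m d₁ d₂ d₃) ≡ (if does d₁ then + 2 else if does d₂ then - (+ 1) else if does d₃ then - (+ 1) else + 0)
total-rowA m (yes _) d₂      d₃      = total-place m (+ 1 ∷ + 1 ∷ [])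
total-rowA m (no _)  (yes _) d₃      = total-place (suc m) (- (+ 1) ∷ [])
total-rowA m (no _)  (no _)  (yes _) = total-place m (- (+ 1) ∷ [])
total-rowA m (no _)  (no _)  (no _)  = refl

y-A : ∀ {n} p m (i : Fin n) t → y (A p m) i t ≡ expA (toℕ i) p m t
y-A p m i t = at-rowA (toℕ i) p m t (toℕ i ℕ.≟ p) (suc (toℕ i) ℕ.≟ p) (toℕ i ℕ.≟ suc p)

y-A⁻¹ : ∀ {n} p m (i : Fin n) t → y (A⁻¹ p m) i t ≡ - y (A p m) i t
y-A⁻¹ p m i t = at-neg (A p m i) t

total-A⁻¹ : ∀ {n} p m (i : Fin n) → total (A⁻¹ p m i) ≡ - cartan (toℕ i) p
total-A⁻¹ p m i = trans (total-neg (A p m i))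
  (cong -_ (total-rowA m (toℕ i ℕ.≟ p) (suc (toℕ i) ℕ.≟ p) (toℕ i ℕ.≟ suc p)))

y-A-self : ∀ {n} k (i : Fin n) t → y (A (toℕ i) k) i t ≡ at (place k (+ 1 ∷ + 1 ∷ [])) t
y-A-self k i t = begin
  y (A r k) i t                                                                ≡⟨ y-A r k i t ⟩
  δ r r * (δ t k + δ t (suc k)) - δ (suc r) r * δ t (suc k) - δ r (suc r) * δ t k
     ≡⟨ cong₂ (λ a b → δ r r * (δ t k + δ t (suc k)) - a * δ t (suc k) - b * δ t k)
              (δ-≢ (suc r) r ℕₚ.1+n≢n) (δ-≢ r (suc r) (ℕₚ.1+n≢n ∘ sym)) ⟩
  δ r r * (δ t k + δ t (suc k)) - + 0 * δ t (suc k) - + 0 * δ t k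
     ≡⟨ cong (λ a → a * (δ t k + δ t (suc k)) - + 0 * δ t (suc k) - + 0 * δ t k) (δ-refl r) ⟩
  + 1 * (δ t k + δ t (suc k)) - + 0 * δ t (suc k) - + 0 * δ t k               ≡⟨ lemma (δ t k) (δ t (suc k)) ⟩
  δ t k * + 1 + δ t (suc k) * + 1                                              ≡⟨ sym (at-place2 k (+ 1) (+ 1) t) ⟩
  at (place k (+ 1 ∷ + 1 ∷ [])) t                                              ∎
  where open ≡-Reasoning
        r = toℕ i
        lemma : ∀ a b → + 1 * (a + b) - + 0 * b - + 0 * a ≡ a * + 1 + b * + 1
        lemma = solve-∀

ε>0⇒total<φ : ∀ {n} (M : Mon n) i → + 0 ℤ.< εM M i → total (M i) ℤ.< φL (M i)
ε>0⇒total<φ M i ε>0 = subst₂ ℤ._<_ (ℤₚ.+-identityʳ (total (M i))) (lemma (total (M i)) (φL (M i))) (ℤₚ.+-monoʳ-< (total (M i)) ε>0)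
  where lemma : ∀ a b → a + (b - a) ≡ b
        lemma = solve-∀

module Respect {n : ℕ} {M N : Mon n} (M≈N : M ≈M N) (i : Fin n) where
  private
    module AM = Argmax (M i)
    module AN = Argmax (N i)

  φ-resp : φL (M i) ≡ φL (N i)
  φ-resp = φL-cong (M i) (N i) (M≈N i)

  ε-resp : εM M i ≡ εM N i
  ε-resp = cong₂ _-_ φ-resp (total-cong (M i) (N i) (M≈N i))

  kbar-resp : kbar M i ≡ kbar N i
  kbar-resp = sym (AN.kbarL-unique (kbar M i)
    (trans (sym (psum-cong (M i) (N i) (M≈N i) (kbar M i))) (trans (proj₁ AM.kbarL-spec) φ-resp))
    (λ j j< → subst₂ ℤ._<_ (psum-cong (M i) (N i) (M≈N i) j) φ-resp (proj₂ AM.kbarL-spec j j<)))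

  kE-resp : + 0 ℤ.< εM M i → kE M i ≡ kE N i
  kE-resp ε>0 = sym (AN.kEL-unique (kE M i)
    (subst₂ ℤ._<_ (total-cong (M i) (N i) (M≈N i)) φ-resp (ε>0⇒total<φ M i ε>0))
    (trans (sym (psum-cong (M i) (N i) (M≈N i) (kE M i))) (trans (proj₁ spec) φ-resp))
    (λ j j> → subst₂ ℤ._<_ (psum-cong (M i) (N i) (M≈N i) j) φ-resp (proj₂ spec j j>)))
    where spec = AM.kEL-spec (ε>0⇒total<φ M i ε>0)

  fM-resp : fM i M ≈M fM i N
  fM-resp i′ t = trans (·-congˡ M N (A⁻¹ (toℕ i) (kbar M i)) M≈N i′ t) (cong (λ k → y (N · A⁻¹ (toℕ i) k) i′ t) kbar-resp)

  eM-resp : MaybeRel _≈M_ (eM i M) (eM i N)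
  eM-resp = byCases (+ 0 ℤₚ.<? εM M i) (+ 0 ℤₚ.<? εM N i)
    where
      byCases : (d : Dec (+ 0 ℤ.< εM M i)) (d′ : Dec (+ 0 ℤ.< εM N i)) →
        MaybeRel _≈M_ (if does d then just (M · A (toℕ i) (kE M i)) else nothing)
                      (if does d′ then just (N · A (toℕ i) (kE N i)) else nothing)
      byCases (yes ε>0) (yes _)  = just λ i′ t → trans (·-congˡ M N (A (toℕ i) (kE M i)) M≈N i′ t)
                                                       (cong (λ k → y (N · A (toℕ i) k) i′ t) (kE-resp ε>0))
      byCases (no _)    (no _)   = nothing
      byCases (yes ε>0) (no ε≯0) = ⊥-elim (ε≯0 (subst (+ 0 ℤ.<_) ε-resp ε>0))
      byCases (no ε≯0)  (yes ε>0) = ⊥-elim (ε≯0 (subst (+ 0 ℤ.<_) (sym ε-resp) ε>0))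

f-after-e : ∀ {n} (M N : Mon n) i → + 0 ℤ.< εM M i → N ≈M (M · A (toℕ i) (kE M i)) → fM i N ≈M M
f-after-e M N i ε>0 N≈ i′ t = begin
  y (N · A⁻¹ r (kbar N i)) i′ t                    ≡⟨ y-· N (A⁻¹ r (kbar N i)) i′ t ⟩
  y N i′ t + y (A⁻¹ r (kbar N i)) i′ t
    ≡⟨ cong₂ _+_ (trans (N≈ i′ t) (y-· M (A r k) i′ t)) (trans (cong (λ z → y (A⁻¹ r z) i′ t) kbar≡k) (y-A⁻¹ r k i′ t)) ⟩
  y M i′ t + y (A r k) i′ t + - y (A r k) i′ t     ≡⟨ lemma (y M i′ t) (y (A r k) i′ t) ⟩
  y M i′ t                                         ∎
  where
    open ≡-Reasoning
    r = toℕ i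
    k = kE M i
    lemma : ∀ a b → a + b + - b ≡ a
    lemma = solve-∀
    kbar≡k : kbar N i ≡ k
    kbar≡k = kbarL-after-bump (M i) (N i) (ε>0⇒total<φ M i ε>0)
      (λ t′ → trans (N≈ i t′) (trans (y-· M (A r k) i t′)
                (trans (cong (λ z → at (M i) t′ + z) (y-A-self k i t′)) (sym (at-addL (M i) (place k (+ 1 ∷ + 1 ∷ [])) t′)))))

Σᴸ : {A : Set} → List A → (A → ℤ) → ℤ
Σᴸ xs g = foldr (λ x acc → g x + acc) (+ 0) xs

module _ {A : Set} where

  Σᴸ-++ : ∀ (xs ys : List A) g → Σᴸ (xs ++ ys) g ≡ Σᴸ xs g + Σᴸ ys g
  Σᴸ-++ []       ys g = sym (ℤₚ.+-identityˡ _)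
  Σᴸ-++ (x ∷ xs) ys g = trans (cong (λ w → g x + w) (Σᴸ-++ xs ys g)) (sym (ℤₚ.+-assoc (g x) _ _))

  Σᴸ-map : ∀ {B : Set} (f : B → A) xs g → Σᴸ (map f xs) g ≡ Σᴸ xs (g ∘ f)
  Σᴸ-map f []       g = refl
  Σᴸ-map f (x ∷ xs) g = cong (λ w → g (f x) + w) (Σᴸ-map f xs g)

  Σᴸ-concatMap : ∀ {B : Set} (f : B → List A) xs g → Σᴸ (concatMap f xs) g ≡ Σᴸ xs (λ x → Σᴸ (f x) g)
  Σᴸ-concatMap f []       g = refl
  Σᴸ-concatMap f (x ∷ xs) g = trans (Σᴸ-++ (f x) (concatMap f xs) g) (cong (λ w → Σᴸ (f x) g + w) (Σᴸ-concatMap f xs g))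

  Σᴸ-cong : ∀ (xs : List A) {g h} → (∀ x → g x ≡ h x) → Σᴸ xs g ≡ Σᴸ xs h
  Σᴸ-cong []       e = refl
  Σᴸ-cong (x ∷ xs) e = cong₂ _+_ (e x) (Σᴸ-cong xs e)

  Σᴸ-+ : ∀ (xs : List A) g h → Σᴸ xs (λ x → g x + h x) ≡ Σᴸ xs g + Σᴸ xs h
  Σᴸ-+ []       g h = refl
  Σᴸ-+ (x ∷ xs) g h = trans (cong (λ w → (g x + h x) + w) (Σᴸ-+ xs g h)) (interchange (g x) (h x) _ _)
    where interchange : ∀ a b c d → (a + b) + (c + d) ≡ (a + c) + (b + d)
          interchange = solve-∀

  Σᴸ-neg : ∀ (xs : List A) g → Σᴸ xs (λ x → - g x) ≡ - Σᴸ xs g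
  Σᴸ-neg []       g = refl
  Σᴸ-neg (x ∷ xs) g = trans (cong (λ w → - g x + w) (Σᴸ-neg xs g)) (sym (ℤₚ.neg-distrib-+ (g x) (Σᴸ xs g)))

  Σᴸ-- : ∀ (xs : List A) g h → Σᴸ xs (λ x → g x - h x) ≡ Σᴸ xs g - Σᴸ xs h
  Σᴸ-- xs g h = trans (Σᴸ-+ xs g (λ x → - h x)) (cong (λ w → Σᴸ xs g + w) (Σᴸ-neg xs h))

Σᴸ-nonneg : ∀ {A : Set} (xs : List A) g → (∀ x → + 0 ℤ.≤ g x) → + 0 ℤ.≤ Σᴸ xs g
Σᴸ-nonneg []       g g≥0 = ℤₚ.≤-refl
Σᴸ-nonneg (x ∷ xs) g g≥0 = ℤₚ.+-mono-≤ (g≥0 x) (Σᴸ-nonneg xs g g≥0)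

Σᴸ-upTo-suc : ∀ m g → Σᴸ (upTo (suc m)) g ≡ Σᴸ (upTo m) g + g m
Σᴸ-upTo-suc m g = trans (cong (λ ds → Σᴸ ds g) (sym (Listₚ.upTo-∷ʳ m)))
  (trans (Σᴸ-++ (upTo m) [ m ] g) (cong (λ w → Σᴸ (upTo m) g + w) (ℤₚ.+-identityʳ (g m))))

Σᴸ-upTo-cons : ∀ m g → Σᴸ (upTo (suc m)) g ≡ g 0 + Σᴸ (upTo m) (g ∘ suc)
Σᴸ-upTo-cons m g = cong (λ w → g 0 + w) (trans (cong (λ ds → Σᴸ ds g) (sym (Listₚ.map-upTo suc m))) (Σᴸ-map suc (upTo m) g))

Σᴸ-upTo-cong : ∀ m {g h} → (∀ x → x < m → g x ≡ h x) → Σᴸ (upTo m) g ≡ Σᴸ (upTo m) h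
Σᴸ-upTo-cong zero    e = refl
Σᴸ-upTo-cong (suc m) {g} {h} e = begin
  Σᴸ (upTo (suc m)) g   ≡⟨ Σᴸ-upTo-suc m g ⟩
  Σᴸ (upTo m) g + g m   ≡⟨ cong₂ _+_ (Σᴸ-upTo-cong m (λ x x<m → e x (ℕₚ.m<n⇒m<1+n x<m))) (e m ℕₚ.≤-refl) ⟩
  Σᴸ (upTo m) h + h m   ≡⟨ sym (Σᴸ-upTo-suc m h) ⟩
  Σᴸ (upTo (suc m)) h   ∎
  where open ≡-Reasoning

Σᴸ-upTo-zero : ∀ m g → (∀ x → x < m → g x ≡ + 0) → Σᴸ (upTo m) g ≡ + 0
Σᴸ-upTo-zero m g e = trans (Σᴸ-upTo-cong m e) (zeros m)
  where zeros : ∀ m → Σᴸ (upTo m) (λ _ → + 0) ≡ + 0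
        zeros zero    = refl
        zeros (suc m) = trans (Σᴸ-upTo-suc m (λ _ → + 0)) (trans (ℤₚ.+-identityʳ _) (zeros m))

Σᴸ-upTo-pick : ∀ m a g → a < m → (∀ x → x < m → x ≢ a → g x ≡ + 0) → Σᴸ (upTo m) g ≡ g a
Σᴸ-upTo-pick (suc m) a g a<1+m e with ℕₚ.m≤n⇒m<n∨m≡n (ℕₚ.≤-pred a<1+m)
... | inj₁ a<m  = trans (Σᴸ-upTo-suc m g)
  (trans (cong₂ _+_ (Σᴸ-upTo-pick m a g a<m (λ x x<m → e x (ℕₚ.m<n⇒m<1+n x<m))) (e m ℕₚ.≤-refl (ℕₚ.<⇒≢ a<m ∘ sym)))
         (ℤₚ.+-identityʳ _))
... | inj₂ refl = trans (Σᴸ-upTo-suc m g)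
  (trans (cong (_+ g a) (Σᴸ-upTo-zero m g (λ x x<m → e x (ℕₚ.m<n⇒m<1+n x<m) (ℕₚ.<⇒≢ x<m))))
         (ℤₚ.+-identityˡ _))

Σᴿ : ℕ → (ℕ → ℕ → ℤ) → ℤ
Σᴿ n F = Σᴸ (allPairs n) (λ jk → F (proj₁ jk) (proj₂ jk))

Σᴿ-nested : ∀ n F → Σᴿ n F ≡ Σᴸ (upTo n) (λ k → Σᴸ (upTo (suc k)) (λ j → F j k))
Σᴿ-nested n F = trans (Σᴸ-concatMap (λ k → map (λ j → j , k) (upTo (suc k))) (upTo n) F′)
  (Σᴸ-cong (upTo n) (λ k → Σᴸ-map (λ j → j , k) (upTo (suc k)) F′))
  where F′ : ℕ × ℕ → ℤ
        F′ jk = F (proj₁ jk) (proj₂ jk)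

Σᴿ-cong : ∀ n {F G} → (∀ j k → j ≤ k → k < n → F j k ≡ G j k) → Σᴿ n F ≡ Σᴿ n G
Σᴿ-cong n {F} {G} e = trans (Σᴿ-nested n F)
  (trans (Σᴸ-upTo-cong n (λ k k<n → Σᴸ-upTo-cong (suc k) (λ j j≤k → e j k (ℕₚ.≤-pred j≤k) k<n)))
         (sym (Σᴿ-nested n G)))

Σᴿ-zero : ∀ n F → (∀ j k → j ≤ k → k < n → F j k ≡ + 0) → Σᴿ n F ≡ + 0
Σᴿ-zero n F e = trans (Σᴿ-nested n F)
  (Σᴸ-upTo-zero n _ (λ k k<n → Σᴸ-upTo-zero (suc k) _ (λ j j≤k → e j k (ℕₚ.≤-pred j≤k) k<n)))

Σᴿ-pick : ∀ n a b F → a ≤ b → b < n →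
  (∀ j k → j ≤ k → k < n → (j ≢ a ⊎ k ≢ b) → F j k ≡ + 0) → Σᴿ n F ≡ F a b
Σᴿ-pick n a b F a≤b b<n e = trans (Σᴿ-nested n F)
  (trans (Σᴸ-upTo-pick n b _ b<n (λ k k<n k≢b → Σᴸ-upTo-zero (suc k) _ (λ j j≤k → e j k (ℕₚ.≤-pred j≤k) k<n (inj₂ k≢b))))
         (Σᴸ-upTo-pick (suc b) a _ (s≤s a≤b) (λ j j≤b j≢a → e j b (ℕₚ.≤-pred j≤b) b<n (inj₁ j≢a))))

-- Every quantity attached to ℓ below (exponents, weight, the potential μ) has this linear form.
summand : ∀ {n} → Kp n → (ℕ → ℕ → ℤ) → ℕ × ℕ → ℤ
summand ℓ w (j , k) = + cnt ℓ j k * w j k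

⟪_∣_⟫ : ∀ {n} → Kp n → (ℕ → ℕ → ℤ) → ℤ
⟪_∣_⟫ {n} ℓ w = Σᴿ n (λ j k → + cnt ℓ j k * w j k)

⟪⟫-cong : ∀ {n} (ℓ : Kp n) {w w′} → (∀ j k → j ≤ k → k < n → w j k ≡ w′ j k) → ⟪ ℓ ∣ w ⟫ ≡ ⟪ ℓ ∣ w′ ⟫
⟪⟫-cong {n} ℓ e = Σᴿ-cong n (λ j k j≤k k<n → cong (λ v → + cnt ℓ j k * v) (e j k j≤k k<n))

⟪⟫-neg : ∀ {n} (ℓ : Kp n) w → ⟪ ℓ ∣ (λ j k → - w j k) ⟫ ≡ - ⟪ ℓ ∣ w ⟫
⟪⟫-neg {n} ℓ w = trans (Σᴸ-cong (allPairs n) (λ jk → sym (ℤₚ.neg-distribʳ-* (+ cnt ℓ (proj₁ jk) (proj₂ jk)) _)))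
                       (Σᴸ-neg (allPairs n) (summand ℓ w))

⟪⟫-- : ∀ {n} (ℓ : Kp n) w w′ → ⟪ ℓ ∣ (λ j k → w j k - w′ j k) ⟫ ≡ ⟪ ℓ ∣ w ⟫ - ⟪ ℓ ∣ w′ ⟫
⟪⟫-- {n} ℓ w w′ = trans (Σᴸ-cong (allPairs n) (λ jk → distrib (+ cnt ℓ (proj₁ jk) (proj₂ jk)) _ _))
                         (Σᴸ-- (allPairs n) (summand ℓ w) (summand ℓ w′))
  where distrib : ∀ c a b → c * (a - b) ≡ c * a - c * b
        distrib = solve-∀

⟪⟫-zero : ∀ {n} (ℓ : Kp n) w → (∀ j k → j ≤ k → k < n → cnt ℓ j k ≡ 0) → ⟪ ℓ ∣ w ⟫ ≡ + 0
⟪⟫-zero {n} ℓ w z = Σᴿ-zero n _ (λ j k j≤k k<n → cong (λ c → + c * w j k) (z j k j≤k k<n))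

cnt-root : ∀ {n} (ℓ : Kp n) j k (p : j ≤ k) (q : k < n) → cnt ℓ j k ≡ ℓ (root j k p q)
cnt-root {n} ℓ j k p q with j ≤? k | k <? n
... | yes p′ | yes q′ = cong₂ (λ a b → ℓ (root j k a b)) (ℕₚ.≤-irrelevant p′ p) (ℕₚ.≤-irrelevant q′ q)
... | no ¬p  | _      = ⊥-elim (¬p p)
... | yes _  | no ¬q  = ⊥-elim (¬q q)

cnt-nonroot : ∀ {n} (ℓ : Kp n) j k → ¬ (j ≤ k × k < n) → cnt ℓ j k ≡ 0
cnt-nonroot {n} ℓ j k ¬root with j ≤? k | k <? n
... | yes p | yes q = ⊥-elim (¬root (p , q))
... | no _  | _     = refl
... | yes _ | no _  = refl

cnt-pos : ∀ {n} (ℓ : Kp n) j k → 0 < cnt ℓ j k → j ≤ k × k < n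
cnt-pos {n} ℓ j k pos with j ≤? k | k <? n
... | yes p | yes q = p , q
... | no _  | _     = ⊥-elim (ℕₚ.<-irrefl refl pos)
... | yes _ | no _  = ⊥-elim (ℕₚ.<-irrefl refl pos)

-- addR a b ℓ and subR a b ℓ are both of the form adjust a b F ℓ (definitionally).
adjust : ∀ {n} → ℕ → ℕ → (ℕ → ℕ) → Kp n → Kp n
adjust a b F ℓ r = if sameRoot a b r then F (ℓ r) else ℓ r

sameRoot-≢ : ∀ {n} {a b j k p q} → (j ≢ a ⊎ k ≢ b) → sameRoot {n} a b (root j k p q) ≡ false
sameRoot-≢ {a = a} {b} {j} {k} (inj₁ j≢a) = cong (_∧ does (k ℕ.≟ b)) (dec-false (j ℕ.≟ a) j≢a)
sameRoot-≢ {a = a} {b} {j} {k} (inj₂ k≢b) =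
  trans (cong (does (j ℕ.≟ a) ∧_) (dec-false (k ℕ.≟ b) k≢b)) (Boolₚ.∧-zeroʳ _)

sameRoot-≡ : ∀ {n} {a b p q} → sameRoot {n} a b (root a b p q) ≡ true
sameRoot-≡ {a = a} {b} = cong₂ _∧_ (dec-true (a ℕ.≟ a) refl) (dec-true (b ℕ.≟ b) refl)

cnt-adjust-≢ : ∀ {n} (ℓ : Kp n) a b F j k → (j ≢ a ⊎ k ≢ b) → cnt (adjust a b F ℓ) j k ≡ cnt ℓ j k
cnt-adjust-≢ {n} ℓ a b F j k ne with j ≤? k | k <? n
... | yes p | yes q = cong (λ s → if s then F (ℓ (root j k p q)) else ℓ (root j k p q)) (sameRoot-≢ {a = a} {b} {j} {k} {p} {q} ne)
... | no _  | _     = refl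
... | yes _ | no _  = refl

cnt-adjust-≡ : ∀ {n} (ℓ : Kp n) a b F → a ≤ b → b < n → cnt (adjust a b F ℓ) a b ≡ F (cnt ℓ a b)
cnt-adjust-≡ ℓ a b F p q = begin
  cnt (adjust a b F ℓ) a b                                           ≡⟨ cnt-root (adjust a b F ℓ) a b p q ⟩
  (if sameRoot a b (root a b p q) then F (ℓ (root a b p q)) else ℓ (root a b p q))
                                     ≡⟨ cong (λ s → if s then F (ℓ (root a b p q)) else ℓ (root a b p q)) (sameRoot-≡ {a = a} {b} {p} {q}) ⟩
  F (ℓ (root a b p q))                                               ≡⟨ cong F (sym (cnt-root ℓ a b p q)) ⟩
  F (cnt ℓ a b)                                                      ∎
  where open ≡-Reasoning

⟪⟫-adjust : ∀ {n} (ℓ : Kp n) a b F s w → a ≤ b → b < n → + F (cnt ℓ a b) ≡ + cnt ℓ a b + s →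
  ⟪ adjust a b F ℓ ∣ w ⟫ ≡ ⟪ ℓ ∣ w ⟫ + s * w a b
⟪⟫-adjust {n} ℓ a b F s w a≤b b<n step = trans (sym (moveˡ ⟪ ℓ′ ∣ w ⟫ ⟪ ℓ ∣ w ⟫)) (cong (λ v → ⟪ ℓ ∣ w ⟫ + v) difference)
  where
    ℓ′ = adjust a b F ℓ
    moveˡ : ∀ x y → y + (x - y) ≡ x
    moveˡ = solve-∀
    atRoot : ∀ c c′ v → c′ ≡ c + s → c′ * v - c * v ≡ s * v
    atRoot c c′ v refl = lemma c s v
      where lemma : ∀ c s v → (c + s) * v - c * v ≡ s * v
            lemma = solve-∀
    difference : ⟪ ℓ′ ∣ w ⟫ - ⟪ ℓ ∣ w ⟫ ≡ s * w a b
    difference = begin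
      ⟪ ℓ′ ∣ w ⟫ - ⟪ ℓ ∣ w ⟫                                 ≡⟨ sym (Σᴸ-- (allPairs n) (summand ℓ′ w) (summand ℓ w)) ⟩
      Σᴿ n (λ j k → + cnt ℓ′ j k * w j k - + cnt ℓ j k * w j k)
        ≡⟨ Σᴿ-pick n a b _ a≤b b<n (λ j k _ _ ne →
             trans (cong (λ c → + c * w j k - + cnt ℓ j k * w j k) (cnt-adjust-≢ ℓ a b F j k ne))
                   (ℤₚ.+-inverseʳ (+ cnt ℓ j k * w j k))) ⟩
      + cnt ℓ′ a b * w a b - + cnt ℓ a b * w a b
        ≡⟨ atRoot (+ cnt ℓ a b) (+ cnt ℓ′ a b) (w a b) (trans (cong +_ (cnt-adjust-≡ ℓ a b F a≤b b<n)) step) ⟩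
      s * w a b                                               ∎
      where open ≡-Reasoning

⟪⟫-addR : ∀ {n} (ℓ : Kp n) a b w → a ≤ b → b < n → ⟪ addR a b ℓ ∣ w ⟫ ≡ ⟪ ℓ ∣ w ⟫ + w a b
⟪⟫-addR ℓ a b w a≤b b<n =
  trans (⟪⟫-adjust ℓ a b suc (+ 1) w a≤b b<n (ℤₚ.+-comm (+ 1) (+ cnt ℓ a b)))
        (cong (λ v → ⟪ ℓ ∣ w ⟫ + v) (ℤₚ.*-identityˡ (w a b)))

⟪⟫-subR : ∀ {n} (ℓ : Kp n) a b w → 0 < cnt ℓ a b → ⟪ subR a b ℓ ∣ w ⟫ ≡ ⟪ ℓ ∣ w ⟫ - w a b
⟪⟫-subR ℓ a b w pos with cnt-pos ℓ a b pos
... | a≤b , b<n = trans (⟪⟫-adjust ℓ a b (_∸ 1) (- + 1) w a≤b b<n (predℤ (cnt ℓ a b) pos))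
                        (cong (λ v → ⟪ ℓ ∣ w ⟫ + v) (trans (sym (ℤₚ.neg-distribˡ-* (+ 1) (w a b)))
                                                           (cong -_ (ℤₚ.*-identityˡ (w a b)))))
  where predℤ : ∀ c → 0 < c → + (c ∸ 1) ≡ + c + - + 1
        predℤ (suc c) _ = refl

δδ-off-diagonal : ∀ a t j k → j ≤ k → (j ≢ a ⊎ k ≢ a ℕ.+ t) → δ a j * δ t (k ∸ j) ≡ + 0
δδ-off-diagonal a t j k j≤k (inj₁ j≢a) = δδ-≢ a t j (k ∸ j) (inj₁ (j≢a ∘ sym))
δδ-off-diagonal a t j k j≤k (inj₂ k≢a+t) with j ℕ.≟ a
... | no j≢a   = δδ-≢ a t j (k ∸ j) (inj₁ (j≢a ∘ sym))
... | yes refl = δδ-≢ j t j (k ∸ j) (inj₂ λ t≡k∸j → k≢a+t (trans (sym (ℕₚ.m+[n∸m]≡n j≤k)) (cong (j ℕ.+_) (sym t≡k∸j))))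

⟪⟫-diagonal : ∀ {n} (ℓ : Kp n) a t → ⟪ ℓ ∣ (λ j k → δ a j * δ t (k ∸ j)) ⟫ ≡ + cnt ℓ a (a ℕ.+ t)
⟪⟫-diagonal {n} ℓ a t = byCases ((a ℕ.+ t) <? n)
  where
    vanish : ∀ j k → j ≤ k → (j ≢ a ⊎ k ≢ a ℕ.+ t) → + cnt ℓ j k * (δ a j * δ t (k ∸ j)) ≡ + 0
    vanish j k j≤k ne = trans (cong (+ cnt ℓ j k *_) (δδ-off-diagonal a t j k j≤k ne)) (ℤₚ.*-zeroʳ (+ cnt ℓ j k))
    byCases : Dec (a ℕ.+ t < n) → ⟪ ℓ ∣ (λ j k → δ a j * δ t (k ∸ j)) ⟫ ≡ + cnt ℓ a (a ℕ.+ t)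
    byCases (yes a+t<n) =
      trans (Σᴿ-pick n a (a ℕ.+ t) _ (ℕₚ.m≤m+n a t) a+t<n (λ j k j≤k _ → vanish j k j≤k))
            (trans (cong (λ v → + cnt ℓ a (a ℕ.+ t) * v)
                         (cong₂ _*_ (δ-refl a) (trans (cong (δ t) (ℕₚ.m+n∸m≡n a t)) (δ-refl t))))
                   (ℤₚ.*-identityʳ _))
    byCases (no ¬a+t<n) =
      trans (Σᴿ-zero n _ (λ j k j≤k k<n → vanish j k j≤k (inj₂ λ { refl → ¬a+t<n k<n })))
            (cong +_ (sym (cnt-nonroot ℓ a (a ℕ.+ t) (¬a+t<n ∘ proj₂))))

y-foldr· : ∀ {n} {X : Set} (F : X → Mon n) xs i t → y (foldr (λ x acc → F x · acc) 𝟏 xs) i t ≡ Σᴸ xs (λ x → y (F x) i t)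
y-foldr· F []       i t = at-[] t
y-foldr· F (x ∷ xs) i t = trans (y-· (F x) (foldr (λ x acc → F x · acc) 𝟏 xs) i t) (cong (λ w → y (F x) i t + w) (y-foldr· F xs i t))

total-foldr· : ∀ {n} {X : Set} (F : X → Mon n) xs i → total (foldr (λ x acc → F x · acc) 𝟏 xs i) ≡ Σᴸ xs (λ x → total (F x i))
total-foldr· F []       i = refl
total-foldr· F (x ∷ xs) i = trans (total-· (F x) (foldr (λ x acc → F x · acc) 𝟏 xs) i) (cong (λ w → total (F x i) + w) (total-foldr· F xs i))

term : ∀ {n} → Kp n → ℕ × ℕ → Mon n
term ℓ (j , k) = pow (block j k) (cnt ℓ j k)

y-monOf : ∀ {n} (ℓ : Kp n) i t → y (monOf ℓ) i t ≡ ⟪ ℓ ∣ (λ j k → y (block j k) i t) ⟫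
y-monOf {n} ℓ i t = trans (y-foldr· (term ℓ) (allPairs n) i t)
  (Σᴸ-cong (allPairs n) (λ jk → y-pow (block (proj₁ jk) (proj₂ jk)) (cnt ℓ (proj₁ jk) (proj₂ jk)) i t))

total-monOf : ∀ {n} (ℓ : Kp n) i → total (monOf ℓ i) ≡ ⟪ ℓ ∣ (λ j k → total (block j k i)) ⟫
total-monOf {n} ℓ i = trans (total-foldr· (term ℓ) (allPairs n) i)
  (Σᴸ-cong (allPairs n) (λ jk → total-pow (block (proj₁ jk) (proj₂ jk)) (cnt ℓ (proj₁ jk) (proj₂ jk)) i))

y-monOf-addR : ∀ {n} (ℓ : Kp n) a b → a ≤ b → b < n → ∀ i t → y (monOf (addR a b ℓ)) i t ≡ y (monOf ℓ) i t + y (block a b) i t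
y-monOf-addR ℓ a b a≤b b<n i t = begin
  y (monOf (addR a b ℓ)) i t                   ≡⟨ y-monOf (addR a b ℓ) i t ⟩
  ⟪ addR a b ℓ ∣ (λ j k → y (block j k) i t) ⟫ ≡⟨ ⟪⟫-addR ℓ a b _ a≤b b<n ⟩
  ⟪ ℓ ∣ (λ j k → y (block j k) i t) ⟫ + y (block a b) i t ≡⟨ cong (_+ y (block a b) i t) (sym (y-monOf ℓ i t)) ⟩
  y (monOf ℓ) i t + y (block a b) i t          ∎
  where open ≡-Reasoning

y-monOf-subR : ∀ {n} (ℓ : Kp n) a b → 0 < cnt ℓ a b → ∀ i t → y (monOf (subR a b ℓ)) i t ≡ y (monOf ℓ) i t - y (block a b) i t
y-monOf-subR ℓ a b pos i t = begin
  y (monOf (subR a b ℓ)) i t                   ≡⟨ y-monOf (subR a b ℓ) i t ⟩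
  ⟪ subR a b ℓ ∣ (λ j k → y (block j k) i t) ⟫ ≡⟨ ⟪⟫-subR ℓ a b _ pos ⟩
  ⟪ ℓ ∣ (λ j k → y (block j k) i t) ⟫ - y (block a b) i t ≡⟨ cong (_- y (block a b) i t) (sym (y-monOf ℓ i t)) ⟩
  y (monOf ℓ) i t - y (block a b) i t          ∎
  where open ≡-Reasoning

monOf-zero : ∀ {n} (ℓ : Kp n) → (∀ j k → j ≤ k → k < n → cnt ℓ j k ≡ 0) → monOf ℓ ≈M 𝟏
monOf-zero ℓ z i t = trans (y-monOf ℓ i t) (trans (⟪⟫-zero ℓ _ z) (sym (at-[] t)))

y-block : ∀ {n} j k (i : Fin n) t → y (block j k) i t ≡ Σᴸ (upTo (suc (k ∸ j))) (λ d → y (A⁻¹ (j ℕ.+ d) (k ∸ (j ℕ.+ d))) i t)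
y-block j k i t = y-foldr· (λ d → A⁻¹ (j ℕ.+ d) (k ∸ (j ℕ.+ d))) (upTo (suc (k ∸ j))) i t

y-block-diag : ∀ {n} j (i : Fin n) t → y (block j j) i t ≡ y (A⁻¹ j 0) i t
y-block-diag j i t = begin
  y (block j j) i t                                                  ≡⟨ y-block j j i t ⟩
  Σᴸ (upTo (suc (j ∸ j))) (λ d → y (A⁻¹ (j ℕ.+ d) (j ∸ (j ℕ.+ d))) i t)
     ≡⟨ cong (λ m → Σᴸ (upTo (suc m)) (λ d → y (A⁻¹ (j ℕ.+ d) (j ∸ (j ℕ.+ d))) i t)) (ℕₚ.n∸n≡0 j) ⟩
  y (A⁻¹ (j ℕ.+ 0) (j ∸ (j ℕ.+ 0))) i t + + 0                       ≡⟨ ℤₚ.+-identityʳ _ ⟩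
  y (A⁻¹ (j ℕ.+ 0) (j ∸ (j ℕ.+ 0))) i t                             ≡⟨ cong (λ p → y (A⁻¹ p (j ∸ p)) i t) (ℕₚ.+-identityʳ j) ⟩
  y (A⁻¹ j (j ∸ j)) i t                                              ≡⟨ cong (λ m → y (A⁻¹ j m) i t) (ℕₚ.n∸n≡0 j) ⟩
  y (A⁻¹ j 0) i t                                                    ∎
  where open ≡-Reasoning

y-block-unfold : ∀ {n} j k → j < k → (i : Fin n) → ∀ t → y (block j k) i t ≡ y (A⁻¹ j (k ∸ j)) i t + y (block (suc j) k) i t
y-block-unfold j k j<k i t = begin
  y (block j k) i t                                        ≡⟨ y-block j k i t ⟩
  Σᴸ (upTo (suc (k ∸ j))) g                                ≡⟨ cong (λ m → Σᴸ (upTo (suc m)) g) k∸j ⟩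
  Σᴸ (upTo (suc (suc (k ∸ suc j)))) g                      ≡⟨ Σᴸ-upTo-cons (suc (k ∸ suc j)) g ⟩
  g 0 + Σᴸ (upTo (suc (k ∸ suc j))) (g ∘ suc)              ≡⟨ cong₂ _+_ first (Σᴸ-cong (upTo (suc (k ∸ suc j))) rest) ⟩
  y (A⁻¹ j (k ∸ j)) i t + Σᴸ (upTo (suc (k ∸ suc j))) g′   ≡⟨ cong (λ w → y (A⁻¹ j (k ∸ j)) i t + w) (sym (y-block (suc j) k i t)) ⟩
  y (A⁻¹ j (k ∸ j)) i t + y (block (suc j) k) i t          ∎
  where
    open ≡-Reasoning
    g g′ : ℕ → ℤ
    g  d = y (A⁻¹ (j ℕ.+ d) (k ∸ (j ℕ.+ d))) i t
    g′ d = y (A⁻¹ (suc j ℕ.+ d) (k ∸ (suc j ℕ.+ d))) i t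
    k∸j : k ∸ j ≡ suc (k ∸ suc j)
    k∸j = ℕₚ.+-cancelˡ-≡ j _ _ (trans (ℕₚ.m+[n∸m]≡n (ℕₚ.<⇒≤ j<k)) (sym (trans (ℕₚ.+-suc j _) (ℕₚ.m+[n∸m]≡n j<k))))
    first : g 0 ≡ y (A⁻¹ j (k ∸ j)) i t
    first = cong (λ p → y (A⁻¹ p (k ∸ p)) i t) (ℕₚ.+-identityʳ j)
    rest : ∀ d → g (suc d) ≡ g′ d
    rest d = cong (λ p → y (A⁻¹ p (k ∸ p)) i t) (ℕₚ.+-suc j d)

y-block-suc : ∀ {n} j x (i : Fin n) t → y (block j (j ℕ.+ x)) i (suc t) ≡ (δ (suc (toℕ i)) j - δ (toℕ i) j) * δ t x
y-block-suc j zero i t = begin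
  y (block j (j ℕ.+ 0)) i (suc t)     ≡⟨ cong (λ k → y (block j k) i (suc t)) (ℕₚ.+-identityʳ j) ⟩
  y (block j j) i (suc t)             ≡⟨ y-block-diag j i (suc t) ⟩
  y (A⁻¹ j 0) i (suc t)               ≡⟨ y-A⁻¹ j 0 i (suc t) ⟩
  - y (A j 0) i (suc t)               ≡⟨ cong -_ (y-A j 0 i (suc t)) ⟩
  - expA (toℕ i) j 0 (suc t)          ≡⟨ lemma (δ (toℕ i) j) (δ (suc (toℕ i)) j) (δ (toℕ i) (suc j)) (δ t 0) ⟩
  (δ (suc (toℕ i)) j - δ (toℕ i) j) * δ t 0 ∎
  where open ≡-Reasoning
        lemma : ∀ a b c d → - (a * (+ 0 + d) - b * d - c * + 0) ≡ (b - a) * d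
        lemma = solve-∀
y-block-suc j (suc x) i t = begin
  y (block j (j ℕ.+ suc x)) i (suc t)
    ≡⟨ y-block-unfold j (j ℕ.+ suc x) (ℕₚ.m<m+n j (s≤s z≤n)) i (suc t) ⟩
  y (A⁻¹ j (j ℕ.+ suc x ∸ j)) i (suc t) + y (block (suc j) (j ℕ.+ suc x)) i (suc t)
    ≡⟨ cong₂ (λ m k → y (A⁻¹ j m) i (suc t) + y (block (suc j) k) i (suc t)) (ℕₚ.m+n∸m≡n j (suc x)) (ℕₚ.+-suc j x) ⟩
  y (A⁻¹ j (suc x)) i (suc t) + y (block (suc j) (suc j ℕ.+ x)) i (suc t)
    ≡⟨ cong₂ _+_ (trans (y-A⁻¹ j (suc x) i (suc t)) (cong -_ (y-A j (suc x) i (suc t)))) (y-block-suc (suc j) x i t) ⟩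
  - expA (toℕ i) j (suc x) (suc t) + (δ (toℕ i) j - δ (toℕ i) (suc j)) * δ t x
    ≡⟨ lemma (δ (toℕ i) j) (δ (suc (toℕ i)) j) (δ (toℕ i) (suc j)) (δ t x) (δ t (suc x)) ⟩
  (δ (suc (toℕ i)) j - δ (toℕ i) j) * δ t (suc x) ∎
  where open ≡-Reasoning
        lemma : ∀ a b c d e → - (a * (d + e) - b * e - c * d) + (a - c) * d ≡ (b - a) * e
        lemma = solve-∀

total-block : ∀ {n} j k (i : Fin n) → total (block j k i) ≡ - pairing (toℕ i) j k
total-block j k i = begin
  total (block j k i)                                                    ≡⟨ total-foldr· A⁻¹ⱼ (upTo (suc (k ∸ j))) i ⟩
  Σᴸ (upTo (suc (k ∸ j))) (λ d → total (A⁻¹ⱼ d i))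
     ≡⟨ Σᴸ-cong (upTo (suc (k ∸ j))) (λ d → total-A⁻¹ (j ℕ.+ d) (k ∸ (j ℕ.+ d)) i) ⟩
  Σᴸ (upTo (suc (k ∸ j))) (λ d → - cartan (toℕ i) (j ℕ.+ d))            ≡⟨ Σᴸ-neg (upTo (suc (k ∸ j))) (λ d → cartan (toℕ i) (j ℕ.+ d)) ⟩
  - pairing (toℕ i) j k                                                  ∎
  where open ≡-Reasoning
        A⁻¹ⱼ : ℕ → Mon _
        A⁻¹ⱼ d = A⁻¹ (j ℕ.+ d) (k ∸ (j ℕ.+ d))

wt-monOf : ∀ {n} (ℓ : Kp n) (i : Fin n) → wtM (monOf ℓ) i ≡ wtK ℓ i
wt-monOf ℓ i = begin
  total (monOf ℓ i)                                  ≡⟨ total-monOf ℓ i ⟩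
  ⟪ ℓ ∣ (λ j k → total (block j k i)) ⟫              ≡⟨ ⟪⟫-cong ℓ (λ j k _ _ → total-block j k i) ⟩
  ⟪ ℓ ∣ (λ j k → - pairing (toℕ i) j k) ⟫            ≡⟨ ⟪⟫-neg ℓ (pairing (toℕ i)) ⟩
  - ⟪ ℓ ∣ pairing (toℕ i) ⟫                          ∎
  where open ≡-Reasoning

y-monOf-suc : ∀ {n} (ℓ : Kp n) (i : Fin n) t →
  y (monOf ℓ) i (suc t) ≡ + cnt ℓ (suc (toℕ i)) (suc (toℕ i) ℕ.+ t) - + cnt ℓ (toℕ i) (toℕ i ℕ.+ t)
y-monOf-suc {n} ℓ i t = begin
  y (monOf ℓ) i (suc t)                                              ≡⟨ y-monOf ℓ i (suc t) ⟩
  ⟪ ℓ ∣ (λ j k → y (block j k) i (suc t)) ⟫                          ≡⟨ ⟪⟫-cong ℓ blockFormula ⟩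
  ⟪ ℓ ∣ (λ j k → δ (suc r) j * δ t (k ∸ j) - δ r j * δ t (k ∸ j)) ⟫
     ≡⟨ ⟪⟫-- ℓ (λ j k → δ (suc r) j * δ t (k ∸ j)) (λ j k → δ r j * δ t (k ∸ j)) ⟩
  ⟪ ℓ ∣ (λ j k → δ (suc r) j * δ t (k ∸ j)) ⟫ - ⟪ ℓ ∣ (λ j k → δ r j * δ t (k ∸ j)) ⟫
                                                                     ≡⟨ cong₂ _-_ (⟪⟫-diagonal ℓ (suc r) t) (⟪⟫-diagonal ℓ r t) ⟩
  + cnt ℓ (suc r) (suc r ℕ.+ t) - + cnt ℓ r (r ℕ.+ t)                 ∎
  where
    open ≡-Reasoning
    r = toℕ i
    blockFormula : ∀ j k → j ≤ k → k < n → y (block j k) i (suc t) ≡ δ (suc r) j * δ t (k ∸ j) - δ r j * δ t (k ∸ j)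
    blockFormula j k j≤k _ = trans (cong (λ k′ → y (block j k′) i (suc t)) (sym (ℕₚ.m+[n∸m]≡n j≤k)))
                                   (trans (y-block-suc j (k ∸ j) i t) (distrib (δ (suc r) j) (δ r j) (δ t (k ∸ j))))
      where distrib : ∀ a b d → (a - b) * d ≡ a * d - b * d
            distrib = solve-∀

monOf-injective : ∀ {n} (ℓ ℓ′ : Kp n) → monOf ℓ ≈M monOf ℓ′ → ℓ ≈K ℓ′
monOf-injective {n} ℓ ℓ′ eq (root j k p q) = begin
  ℓ (root j k p q)          ≡⟨ sym (cnt-root ℓ j k p q) ⟩
  cnt ℓ j k                 ≡⟨ cong (cnt ℓ j) (sym (ℕₚ.m+[n∸m]≡n p)) ⟩
  cnt ℓ j (j ℕ.+ (k ∸ j))   ≡⟨ rowsAgree (n ∸ j) j (ℕₚ.m≤n+m∸n n j) (k ∸ j) ⟩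
  cnt ℓ′ j (j ℕ.+ (k ∸ j))  ≡⟨ cong (cnt ℓ′ j) (ℕₚ.m+[n∸m]≡n p) ⟩
  cnt ℓ′ j k                ≡⟨ cnt-root ℓ′ j k p q ⟩
  ℓ′ (root j k p q)         ∎
  where
    open ≡-Reasoning
    rowsAgree : ∀ d a → n ≤ a ℕ.+ d → ∀ t → cnt ℓ a (a ℕ.+ t) ≡ cnt ℓ′ a (a ℕ.+ t)
    rowsAgree d a n≤a+d t with a <? n
    ... | no a≮n = trans (cnt-nonroot ℓ a (a ℕ.+ t) outside) (sym (cnt-nonroot ℓ′ a (a ℕ.+ t) outside))
      where outside : ¬ (a ≤ a ℕ.+ t × a ℕ.+ t < n)
            outside (_ , a+t<n) = a≮n (ℕₚ.≤-<-trans (ℕₚ.m≤m+n a t) a+t<n)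
    rowsAgree zero    a n≤a t | yes a<n = ⊥-elim (ℕₚ.<⇒≱ a<n (subst (n ≤_) (ℕₚ.+-identityʳ a) n≤a))
    rowsAgree (suc d) a n≤a+d t | yes a<n = ℤₚ.+-injective (begin
      + cnt ℓ a (a ℕ.+ t)            ≡⟨ lemma (+ cnt ℓ (suc a) (suc a ℕ.+ t)) (+ cnt ℓ a (a ℕ.+ t)) ⟩
      X ℓ - (X ℓ - + cnt ℓ a (a ℕ.+ t))
        ≡⟨ cong₂ _-_ (cong +_ (rowsAgree d (suc a) (subst (n ≤_) (ℕₚ.+-suc a d) n≤a+d) t))
                     (trans (sym (row ℓ)) (trans (eq (fromℕ< a<n) (suc t)) (row ℓ′))) ⟩
      X ℓ′ - (X ℓ′ - + cnt ℓ′ a (a ℕ.+ t)) ≡⟨ sym (lemma (+ cnt ℓ′ (suc a) (suc a ℕ.+ t)) (+ cnt ℓ′ a (a ℕ.+ t))) ⟩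
      + cnt ℓ′ a (a ℕ.+ t)            ∎)
      where
        X : Kp n → ℤ
        X m = + cnt m (suc a) (suc a ℕ.+ t)
        lemma : ∀ x c → c ≡ x - (x - c)
        lemma = solve-∀
        row : ∀ m → y (monOf m) (fromℕ< a<n) (suc t) ≡ X m - + cnt m a (a ℕ.+ t)
        row m = trans (y-monOf-suc m (fromℕ< a<n) t)
          (cong (λ r → + cnt m (suc r) (suc r ℕ.+ t) - + cnt m r (r ℕ.+ t)) (Finₚ.toℕ-fromℕ< a<n))

+-∸ : ∀ m k → k ≤ m → + (m ∸ k) ≡ + m - + k
+-∸ m k k≤m = trans (sym (ℤₚ.⊖-≥ k≤m)) (sym (ℤₚ.[+m]-[+n]≡m⊖n m k))

i≡j-d⇒i≤j : ∀ {i j} d → i ≡ j - + d → i ℤ.≤ j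
i≡j-d⇒i≤j {i} {j} d refl = ℤₚ.≤-trans (ℤₚ.+-monoʳ-≤ j (ℤₚ.neg-mono-≤ (ℤ.+≤+ z≤n))) (ℤₚ.≤-reflexive (ℤₚ.+-identityʳ j))

i≡j-1+d⇒i<j : ∀ {i j} d → i ≡ j - + suc d → i ℤ.< j
i≡j-1+d⇒i<j {i} {j} d refl = ℤₚ.<-≤-trans (ℤₚ.+-monoʳ-< j ℤ.-<+) (ℤₚ.≤-reflexive (ℤₚ.+-identityʳ j))

j≡i+1+d⇒i<j : ∀ {i j} d → j ≡ i + + suc d → i ℤ.< j
j≡i+1+d⇒i<j {i} d refl = i≡j-1+d⇒i<j d (sym (lemma i (+ suc d)))
  where lemma : ∀ a b → a + b - b ≡ a
        lemma = solve-∀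

∸-suc : ∀ n m → m < n → n ∸ m ≡ suc (n ∸ suc m)
∸-suc (suc n) zero    _         = refl
∸-suc (suc n) (suc m) (s≤s m<n) = ∸-suc n m m<n

tailSum : (ℕ → ℤ) → ℕ → ℕ → ℤ
tailSum g zero    m = + 0
tailSum g (suc F) m = g m + tailSum g F (suc m)

scanFrom : List Tok → List ℕ × List ℕ → List ℕ × List ℕ
scanFrom ts (cs , os) = scan ts cs os

scan-++ : ∀ xs ys cs os → scan (xs ++ ys) cs os ≡ scanFrom ys (scan xs cs os)
scan-++ []            ys cs os       = refl
scan-++ (cl m ∷ xs)   ys cs (o ∷ os) = scan-++ xs ys cs os
scan-++ (cl m ∷ xs)   ys cs []       = scan-++ xs ys (m ∷ cs) []
scan-++ (op m ∷ xs)   ys cs os       = scan-++ xs ys cs (m ∷ os)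

replicate-∷ʳ : ∀ {X : Set} c (x : X) xs → replicate c x ++ x ∷ xs ≡ x ∷ replicate c x ++ xs
replicate-∷ʳ zero    x xs = refl
replicate-∷ʳ (suc c) x xs = cong (x ∷_) (replicate-∷ʳ c x xs)

scan-closers-≤ : ∀ c m cs os → c ≤ length os → scan (replicate c (cl m)) cs os ≡ (cs , drop c os)
scan-closers-≤ zero    m cs os       _        = refl
scan-closers-≤ (suc c) m cs (o ∷ os) (s≤s le) = scan-closers-≤ c m cs os le

scan-closers-≥ : ∀ c m cs os → length os ≤ c → scan (replicate c (cl m)) cs os ≡ (replicate (c ∸ length os) m ++ cs , [])
scan-closers-≥ c       m cs []       _        = unmatched c cs
  where unmatched : ∀ c cs → scan (replicate c (cl m)) cs [] ≡ (replicate c m ++ cs , [])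
        unmatched zero    cs = refl
        unmatched (suc c) cs = trans (unmatched c (m ∷ cs)) (cong (_, []) (replicate-∷ʳ c m cs))
scan-closers-≥ (suc c) m cs (o ∷ os) (s≤s le) = scan-closers-≥ c m cs os le

scan-openers : ∀ o m cs os → scan (replicate o (op m)) cs os ≡ (cs , replicate o m ++ os)
scan-openers zero    m cs os = refl
scan-openers (suc o) m cs os = trans (scan-openers o m cs (m ∷ os)) (cong (cs ,_) (replicate-∷ʳ o m os))

last-∷ : ∀ (x : ℕ) xs → ∃ λ z → last (x ∷ xs) ≡ just z
last-∷ x []       = x , refl
last-∷ x (y ∷ xs) = last-∷ y xs

last-++-∷ : ∀ (xs : List ℕ) y ys → last (xs ++ y ∷ ys) ≡ last (y ∷ ys)
last-++-∷ []            y ys = refl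
last-++-∷ (x ∷ [])      y ys = refl
last-++-∷ (x ∷ x′ ∷ xs) y ys = last-++-∷ (x′ ∷ xs) y ys

last-replicate : ∀ o (m l : ℕ) → last (replicate o m ++ []) ≡ just l → l ≡ m × 0 < o
last-replicate (suc zero)    m .m refl = refl , s≤s z≤n
last-replicate (suc (suc o)) m l  e    = proj₁ (last-replicate (suc o) m l e) , s≤s z≤n

last-drop : ∀ c (os : List ℕ) → c < length os → last (drop c os) ≡ last os
last-drop zero    os                _         = refl
last-drop (suc c) (o ∷ [])          (s≤s ())
last-drop (suc c) (o ∷ o′ ∷ os)     (s≤s c<)  = last-drop c (o′ ∷ os) c<

last-replicate-drop : ∀ o (m : ℕ) c os l → c < length os → last (replicate o m ++ drop c os) ≡ just l → last os ≡ just l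
last-replicate-drop o m c os l c< e with drop c os in eq
... | [] = ⊥-elim (ℕₚ.<-irrefl (sym (trans (sym (Listₚ.length-drop c os)) (cong length eq))) (ℕₚ.m<n⇒0<n∸m c<))
... | y ∷ ys = begin
  last os                         ≡⟨ sym (last-drop c os c<) ⟩
  last (drop c os)                ≡⟨ cong last eq ⟩
  last (y ∷ ys)                   ≡⟨ sym (last-++-∷ (replicate o m) y ys) ⟩
  last (replicate o m ++ y ∷ ys)  ≡⟨ e ⟩
  just l                          ∎
  where open ≡-Reasoning

drop-all : ∀ c (os : List ℕ) → c ≡ length os → drop c os ≡ []
drop-all zero    []       _  = refl
drop-all (suc c) (o ∷ os) eq = drop-all c os (ℕₚ.suc-injective eq)

tailSum-- : ∀ f g F m → tailSum (λ x → f x - g x) F m ≡ tailSum f F m - tailSum g F m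
tailSum-- f g zero    m = refl
tailSum-- f g (suc F) m = trans (cong (λ z → f m - g m + z) (tailSum-- f g F (suc m))) (lemma (f m) (g m) (tailSum f F (suc m)) (tailSum g F (suc m)))
  where lemma : ∀ a b c d → a - b + (c - d) ≡ a + c - (b + d)
        lemma = solve-∀

tailSum-shift : ∀ g F m → tailSum (g ∘ suc) F m ≡ tailSum g F (suc m)
tailSum-shift g zero    m = refl
tailSum-shift g (suc F) m = cong (λ z → g (suc m) + z) (tailSum-shift g F (suc m))

tailSum-snoc : ∀ g F m → tailSum g (suc F) m ≡ tailSum g F m + g (m ℕ.+ F)
tailSum-snoc g zero    m = trans (ℤₚ.+-identityʳ (g m)) (trans (cong g (sym (ℕₚ.+-identityʳ m))) (sym (ℤₚ.+-identityˡ _)))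
tailSum-snoc g (suc F) m = trans (cong (λ z → g m + z) (tailSum-snoc g F (suc m)))
  (trans (sym (ℤₚ.+-assoc (g m) _ _)) (cong (λ z → tailSum g (suc F) m + g z) (sym (ℕₚ.+-suc m F))))

tailSum-nonneg : ∀ g → (∀ x → + 0 ℤ.≤ g x) → ∀ F m → + 0 ℤ.≤ tailSum g F m
tailSum-nonneg g g≥0 zero    m = ℤₚ.≤-refl
tailSum-nonneg g g≥0 (suc F) m = ℤₚ.+-mono-≤ (g≥0 m) (tailSum-nonneg g g≥0 F (suc m))

term≤tailSum : ∀ g → (∀ x → + 0 ℤ.≤ g x) → ∀ F m d → d < F → g (m ℕ.+ d) ℤ.≤ tailSum g F m
term≤tailSum g g≥0 (suc F) m zero    _ =
  subst (ℤ._≤ tailSum g (suc F) m) (cong g (sym (ℕₚ.+-identityʳ m)))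
        (subst (ℤ._≤ g m + tailSum g F (suc m)) (ℤₚ.+-identityʳ (g m)) (ℤₚ.+-monoʳ-≤ (g m) (tailSum-nonneg g g≥0 F (suc m))))
term≤tailSum g g≥0 (suc F) m (suc d) (s≤s d<F) =
  subst (ℤ._≤ tailSum g (suc F) m) (cong g (sym (ℕₚ.+-suc m d)))
        (subst (ℤ._≤ g m + tailSum g F (suc m)) (ℤₚ.+-identityˡ _) (ℤₚ.+-mono-≤ (g≥0 m) (term≤tailSum g g≥0 F (suc m) d d<F)))

-- S_r(ℓ) is the concatenation, for m from n - 1 down to r, of the blocks block-tokens m (rows are 0-based).
module Profile {n : ℕ} (ℓ : Kp n) (r : ℕ) where

  closers openers : ℕ → ℕ
  closers m = cnt ℓ r m
  openers m = cnt ℓ (suc r) m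

  block-tokens : ℕ → List Tok
  block-tokens m = replicate (closers m) (cl m) ++ replicate (openers m) (op m)

  -- R m = (closing brackets in the blocks ≥ m) - (opening brackets in the blocks > m); up to a constant
  -- it is the sequence of partial sums of row r of monOf ℓ, shifted by r.
  R : ℕ → ℤ
  R m = tailSum (λ m′ → + closers m′ - + openers (suc m′)) (n ∸ m) m

  closers-beyond : ∀ m → n ≤ m → closers m ≡ 0
  closers-beyond m n≤m = cnt-nonroot ℓ r m (λ (_ , m<n) → ℕₚ.<⇒≱ m<n n≤m)

  openers-beyond : ∀ m → n ≤ m → openers m ≡ 0
  openers-beyond m n≤m = cnt-nonroot ℓ (suc r) m (λ (_ , m<n) → ℕₚ.<⇒≱ m<n n≤m)

  openers-r : openers r ≡ 0
  openers-r = cnt-nonroot ℓ (suc r) r (λ (r<r , _) → ℕₚ.<-irrefl refl r<r)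

  R-beyond : ∀ m → n ≤ m → R m ≡ + 0
  R-beyond m n≤m rewrite ℕₚ.m≤n⇒m∸n≡0 n≤m = refl

  R-step : ∀ m → R m ≡ + closers m - + openers (suc m) + R (suc m)
  R-step m = byCases (m <? n)
    where
      byCases : Dec (m < n) → R m ≡ + closers m - + openers (suc m) + R (suc m)
      byCases (yes m<n) rewrite ∸-suc n m m<n = refl
      byCases (no m≮n) = trans (R-beyond m n≤m) (sym (cong₂ _+_
        (cong₂ (λ a b → + a - + b) (closers-beyond m n≤m) (openers-beyond (suc m) (ℕₚ.m≤n⇒m≤1+n n≤m)))
        (R-beyond (suc m) (ℕₚ.m≤n⇒m≤1+n n≤m))))
        where n≤m = ℕₚ.≮⇒≥ m≮n

  IsLastMax : ℕ → ℕ → ℕ → Set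
  IsLastMax m L h = m ≤ h × R h ≡ + L × (∀ m′ → h < m′ → R m′ ℤ.< + L) × 0 < closers h

  IsFirstMax : ℕ → ℕ → ℕ → Set
  IsFirstMax m L l = m ≤ l × R l ≡ + L × (∀ m′ → m ≤ m′ → m′ < l → R m′ ℤ.< + L) × 0 < openers l

  -- The state after reading the blocks m′ ≥ m: there are max_{m′≥m} R m′ uncanceled closing brackets,
  -- the rightmost of them sits at the last maximum, and the leftmost uncanceled opening one at the first.
  record Scanned (m : ℕ) (cs os : List ℕ) : Set where
    field
      bounded   : ∀ m′ → m ≤ m′ → R m′ ℤ.≤ + length cs
      attained  : ∃ λ m* → m ≤ m* × R m* ≡ + length cs
      balanced  : + length cs ≡ R m - + openers m + + length os
      rightmost : ∀ h t → cs ≡ h ∷ t → IsLastMax m (length cs) h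
      leftmost  : ∀ l → last os ≡ just l → IsFirstMax m (length cs) l

  Scanned′ : ℕ → List ℕ × List ℕ → Set
  Scanned′ m (cs , os) = Scanned m cs os

  scanned-start : Scanned n [] []
  scanned-start = record
    { bounded   = λ m′ n≤m′ → ℤₚ.≤-reflexive (R-beyond m′ n≤m′)
    ; attained  = n , ℕₚ.≤-refl , R-beyond n ℕₚ.≤-refl
    ; balanced  = sym (cong₂ (λ a b → a - + b + + 0) (R-beyond n ℕₚ.≤-refl) (openers-beyond n ℕₚ.≤-refl))
    ; rightmost = λ _ _ ()
    ; leftmost  = λ _ ()
    }

  module Step (m : ℕ) (cs os : List ℕ) (S : Scanned (suc m) cs os) where
    open Scanned S
    private
      L u c o : ℕ
      L = length cs
      u = length os
      c = closers m
      o = openers m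

    R-m : R m ≡ + L - + u + + c
    R-m = trans (R-step m) (trans (lemma (+ c) (+ openers (suc m)) (R (suc m)) (+ u)) (cong (λ z → z - + u + + c) (sym balanced)))
      where lemma : ∀ c o R′ u → c - o + R′ ≡ R′ - o + u - u + c
            lemma = solve-∀

    module _ (c≤u : c ≤ u) where

      matched-bounded : ∀ m′ → m ≤ m′ → R m′ ℤ.≤ + L
      matched-bounded m′ m≤m′ with ℕₚ.m≤n⇒m<n∨m≡n m≤m′
      ... | inj₁ m<m′ = bounded m′ m<m′
      ... | inj₂ refl = i≡j-d⇒i≤j (u ∸ c) (trans R-m (trans (lemma (+ L) (+ u) (+ c)) (cong (λ z → + L - z) (sym (+-∸ u c c≤u)))))
        where lemma : ∀ L u c → L - u + c ≡ L - (u - c)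
              lemma = solve-∀

      matched-balanced : + L ≡ R m - + o + + length (replicate o m ++ drop c os)
      matched-balanced = sym (begin
        R m - + o + + length (replicate o m ++ drop c os)
          ≡⟨ cong (λ z → R m - + o + + z) (trans (Listₚ.length-++ (replicate o m)) (cong₂ ℕ._+_ (Listₚ.length-replicate o) (Listₚ.length-drop c os))) ⟩
        R m - + o + + (o ℕ.+ (u ∸ c))
          ≡⟨ cong₂ (λ a b → a - + o + b) R-m (trans (ℤₚ.pos-+ o (u ∸ c)) (cong (λ z → + o + z) (+-∸ u c c≤u))) ⟩
        + L - + u + + c - + o + (+ o + (+ u - + c))
          ≡⟨ lemma (+ L) (+ u) (+ c) (+ o) ⟩
        + L ∎)
        where open ≡-Reasoning
              lemma : ∀ L u c o → L - u + c - o + (o + (u - c)) ≡ L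
              lemma = solve-∀

      matched-leftmost : ∀ l → last (replicate o m ++ drop c os) ≡ just l → IsFirstMax m L l
      matched-leftmost l e with ℕₚ.m≤n⇒m<n∨m≡n c≤u
      ... | inj₁ c<u with leftmost l (last-replicate-drop o m c os l c<u e)
      ...   | m<l , Rl , before , pos = ℕₚ.<⇒≤ m<l , Rl , before′ , pos
        where
          before′ : ∀ m′ → m ≤ m′ → m′ < l → R m′ ℤ.< + L
          before′ m′ m≤m′ m′<l with ℕₚ.m≤n⇒m<n∨m≡n m≤m′
          ... | inj₁ m<m′ = before m′ m<m′ m′<l
          ... | inj₂ refl = i≡j-1+d⇒i<j (u ∸ suc c)
                  (trans R-m (trans (lemma (+ L) (+ u) (+ c)) (cong (λ z → + L - (+ 1 + z)) (sym (+-∸ u (suc c) c<u)))))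
            where lemma : ∀ L u c → L - u + c ≡ L - (+ 1 + (u - (+ 1 + c)))
                  lemma = solve-∀
      matched-leftmost l e | inj₂ c≡u with last-replicate o m l (subst (λ z → last (replicate o m ++ z) ≡ just l) (drop-all c os c≡u) e)
      ...   | refl , pos = ℕₚ.≤-refl , trans R-m (trans (cong (λ z → + L - + u + + z) c≡u) (lemma (+ L) (+ u))) ,
                           (λ m′ m≤m′ m′<m → ⊥-elim (ℕₚ.<⇒≱ m′<m m≤m′)) , pos
        where lemma : ∀ L u → L - u + u ≡ L
              lemma = solve-∀

      all-matched : Scanned m cs (replicate o m ++ drop c os)
      all-matched = record
        { bounded   = matched-bounded
        ; attained  = let m* , m<m* , e = attained in m* , ℕₚ.<⇒≤ m<m* , e
        ; balanced  = matched-balanced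
        ; rightmost = λ h t e → let m<h , Rh , after , pos = rightmost h t e in ℕₚ.<⇒≤ m<h , Rh , after , pos
        ; leftmost  = matched-leftmost
        }

    some-unmatched : u < c → Scanned m (replicate (c ∸ u) m ++ cs) (replicate o m ++ [])
    some-unmatched u<c = record
      { bounded   = bounded′
      ; attained  = m , ℕₚ.≤-refl , R-m≡L′
      ; balanced  = sym (trans (cong (λ z → R m - + o + + z) (trans (Listₚ.length-++ (replicate o m)) (trans (ℕₚ.+-identityʳ _) (Listₚ.length-replicate o))))
                               (trans (lemma (R m) (+ o)) R-m≡L′))
      ; rightmost = rightmost′
      ; leftmost  = leftmost′
      }
      where
        lemma : ∀ a b → a - b + b ≡ a
        lemma = solve-∀
        L′ = length (replicate (c ∸ u) m ++ cs)
        L′≡ : + L′ ≡ + L + + (c ∸ u)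
        L′≡ = trans (cong +_ (trans (Listₚ.length-++ (replicate (c ∸ u) m))
                                    (trans (cong (ℕ._+ L) (Listₚ.length-replicate (c ∸ u))) (ℕₚ.+-comm (c ∸ u) L))))
                    (ℤₚ.pos-+ L (c ∸ u))
        R-m≡L′ : R m ≡ + L′
        R-m≡L′ = trans R-m (trans (lemma′ (+ L) (+ u) (+ c)) (trans (cong (λ z → + L + z) (sym (+-∸ c u (ℕₚ.<⇒≤ u<c)))) (sym L′≡)))
          where lemma′ : ∀ L u c → L - u + c ≡ L + (c - u)
                lemma′ = solve-∀
        excess : ∃ λ k → c ∸ u ≡ suc k
        excess with c ∸ u | ℕₚ.m<n⇒0<n∸m u<c
        ... | suc k | _ = k , refl
        L<L′ : + L ℤ.< + L′
        L<L′ = j≡i+1+d⇒i<j (proj₁ excess) (trans L′≡ (cong (λ z → + L + + z) (proj₂ excess)))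
        bounded′ : ∀ m′ → m ≤ m′ → R m′ ℤ.≤ + L′
        bounded′ m′ m≤m′ with ℕₚ.m≤n⇒m<n∨m≡n m≤m′
        ... | inj₁ m<m′ = ℤₚ.<⇒≤ (ℤₚ.≤-<-trans (bounded m′ m<m′) L<L′)
        ... | inj₂ refl = ℤₚ.≤-reflexive R-m≡L′
        leftmost′ : ∀ l → last (replicate o m ++ []) ≡ just l → IsFirstMax m L′ l
        leftmost′ l e with last-replicate o m l e
        ... | refl , pos = ℕₚ.≤-refl , R-m≡L′ , (λ m′ m≤m′ m′<m → ⊥-elim (ℕₚ.<⇒≱ m′<m m≤m′)) , pos
        rightmost′ : ∀ h t → replicate (c ∸ u) m ++ cs ≡ h ∷ t → IsLastMax m L′ h
        rightmost′ h t e with Listₚ.∷-injectiveˡ (subst (λ z → replicate z m ++ cs ≡ h ∷ t) (proj₂ excess) e)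
        ... | refl = ℕₚ.≤-refl , R-m≡L′ , (λ m′ m<m′ → ℤₚ.≤-<-trans (bounded m′ m<m′) L<L′) , ℕₚ.≤-<-trans z≤n u<c

    step : Scanned′ m (scan (block-tokens m) cs os)
    step with c ≤? u
    ... | yes c≤u = subst (Scanned′ m) (sym (begin
            scan (block-tokens m) cs os ≡⟨ scan-++ (replicate c (cl m)) (replicate o (op m)) cs os ⟩
            scanFrom (replicate o (op m)) (scan (replicate c (cl m)) cs os)
              ≡⟨ cong (scanFrom (replicate o (op m))) (scan-closers-≤ c m cs os c≤u) ⟩
            scan (replicate o (op m)) cs (drop c os) ≡⟨ scan-openers o m cs (drop c os) ⟩
            (cs , replicate o m ++ drop c os) ∎)) (all-matched c≤u)
      where open ≡-Reasoning
    ... | no c≰u = subst (Scanned′ m) (sym (begin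
            scan (block-tokens m) cs os ≡⟨ scan-++ (replicate c (cl m)) (replicate o (op m)) cs os ⟩
            scanFrom (replicate o (op m)) (scan (replicate c (cl m)) cs os)
              ≡⟨ cong (scanFrom (replicate o (op m))) (scan-closers-≥ c m cs os (ℕₚ.<⇒≤ (ℕₚ.≰⇒> c≰u))) ⟩
            scan (replicate o (op m)) (replicate (c ∸ u) m ++ cs) [] ≡⟨ scan-openers o m (replicate (c ∸ u) m ++ cs) [] ⟩
            (replicate (c ∸ u) m ++ cs , replicate o m ++ []) ∎)) (some-unmatched (ℕₚ.≰⇒> c≰u))
      where open ≡-Reasoning

  private
    no-blocks-below : ∀ k → k ≤ suc r → filter (r <?_) (downFrom k) ≡ []
    no-blocks-below zero    _         = refl
    no-blocks-below (suc k) (s≤s k≤r) =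
      trans (Listₚ.filter-reject (r <?_) (ℕₚ.≤⇒≯ k≤r)) (no-blocks-below k (ℕₚ.m≤n⇒m≤1+n k≤r))

    blocks-from : ∀ k → concatMap block-tokens (filter (r <?_) (downFrom (suc (r ℕ.+ k)))) ++ replicate (closers r) (cl r)
                        ≡ concatMap block-tokens (map (r ℕ.+_) (downFrom (suc k)))
    blocks-from zero = begin
      concatMap block-tokens (filter (r <?_) (downFrom (suc (r ℕ.+ 0)))) ++ replicate (closers r) (cl r)
        ≡⟨ cong (λ z → concatMap block-tokens z ++ replicate (closers r) (cl r))
                (no-blocks-below (suc (r ℕ.+ 0)) (s≤s (ℕₚ.≤-reflexive (ℕₚ.+-identityʳ r)))) ⟩
      replicate (closers r) (cl r)
        ≡⟨ sym (trans (cong (λ z → replicate (closers r) (cl r) ++ replicate z (op r)) openers-r) (Listₚ.++-identityʳ _)) ⟩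
      block-tokens r
        ≡⟨ cong block-tokens (sym (ℕₚ.+-identityʳ r)) ⟩
      block-tokens (r ℕ.+ 0)
        ≡⟨ sym (Listₚ.++-identityʳ (block-tokens (r ℕ.+ 0))) ⟩
      concatMap block-tokens (map (r ℕ.+_) (downFrom 1)) ∎
      where open ≡-Reasoning
    blocks-from (suc k) = begin
      concatMap block-tokens (filter (r <?_) (downFrom (suc (r ℕ.+ suc k)))) ++ replicate (closers r) (cl r)
        ≡⟨ cong (λ z → concatMap block-tokens z ++ replicate (closers r) (cl r))
                (Listₚ.filter-accept (r <?_) {x = r ℕ.+ suc k} (ℕₚ.≤-trans (s≤s (ℕₚ.m≤m+n r k)) (ℕₚ.≤-reflexive (sym (ℕₚ.+-suc r k))))) ⟩
      (block-tokens (r ℕ.+ suc k) ++ concatMap block-tokens (filter (r <?_) (downFrom (r ℕ.+ suc k)))) ++ replicate (closers r) (cl r)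
        ≡⟨ Listₚ.++-assoc (block-tokens (r ℕ.+ suc k)) _ (replicate (closers r) (cl r)) ⟩
      block-tokens (r ℕ.+ suc k) ++ (concatMap block-tokens (filter (r <?_) (downFrom (r ℕ.+ suc k))) ++ replicate (closers r) (cl r))
        ≡⟨ cong (λ z → block-tokens (r ℕ.+ suc k) ++ (concatMap block-tokens (filter (r <?_) (downFrom z)) ++ replicate (closers r) (cl r)))
                (ℕₚ.+-suc r k) ⟩
      block-tokens (r ℕ.+ suc k) ++ (concatMap block-tokens (filter (r <?_) (downFrom (suc (r ℕ.+ k)))) ++ replicate (closers r) (cl r))
        ≡⟨ cong (block-tokens (r ℕ.+ suc k) ++_) (blocks-from k) ⟩
      concatMap block-tokens (map (r ℕ.+_) (downFrom (suc (suc k)))) ∎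
      where open ≡-Reasoning

    read-blocks : ∀ k cs os → Scanned (r ℕ.+ k) cs os → Scanned′ r (scan (concatMap block-tokens (map (r ℕ.+_) (downFrom k))) cs os)
    read-blocks zero    cs os S = subst (λ z → Scanned z cs os) (ℕₚ.+-identityʳ r) S
    read-blocks (suc k) cs os S =
      subst (Scanned′ r) (sym (scan-++ (block-tokens (r ℕ.+ k)) (concatMap block-tokens (map (r ℕ.+_) (downFrom k))) cs os))
            (read-blocks k _ _ (Step.step (r ℕ.+ k) cs os (subst (λ z → Scanned z cs os) (ℕₚ.+-suc r k) S)))

  scanned-string : r < n → Scanned′ r (scan (string r ℓ) [] [])
  scanned-string r<n = subst (λ z → Scanned′ r (scan z [] [])) (sym string≡)
    (read-blocks (suc K) [] [] (subst (λ z → Scanned z [] []) (sym (trans (ℕₚ.+-suc r K) 1+r+K≡n)) scanned-start))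
    where
      K = n ∸ suc r
      1+r+K≡n : suc (r ℕ.+ K) ≡ n
      1+r+K≡n = ℕₚ.m+[n∸m]≡n r<n
      string≡ : string r ℓ ≡ concatMap block-tokens (map (r ℕ.+_) (downFrom (suc K)))
      string≡ = trans (cong (λ z → concatMap block-tokens (filter (r <?_) (downFrom z)) ++ replicate (closers r) (cl r)) (sym 1+r+K≡n))
                      (blocks-from K)

monOf-f-move : ∀ {n} (ℓ : Kp n) a l → a < l → 0 < cnt ℓ (suc a) l → monOf (addR a l (subR (suc a) l ℓ)) ≈M (monOf ℓ · A⁻¹ a (l ∸ a))
monOf-f-move ℓ a l a<l pos i t with cnt-pos ℓ (suc a) l pos
... | _ , l<n = begin
  y (monOf (addR a l (subR (suc a) l ℓ))) i t                          ≡⟨ y-monOf-addR (subR (suc a) l ℓ) a l (ℕₚ.<⇒≤ a<l) l<n i t ⟩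
  y (monOf (subR (suc a) l ℓ)) i t + y (block a l) i t                 ≡⟨ cong₂ _+_ (y-monOf-subR ℓ (suc a) l pos i t) (y-block-unfold a l a<l i t) ⟩
  y (monOf ℓ) i t - y (block (suc a) l) i t + (y (A⁻¹ a (l ∸ a)) i t + y (block (suc a) l) i t)
                                                                       ≡⟨ lemma (y (monOf ℓ) i t) (y (block (suc a) l) i t) (y (A⁻¹ a (l ∸ a)) i t) ⟩
  y (monOf ℓ) i t + y (A⁻¹ a (l ∸ a)) i t                              ≡⟨ sym (y-· (monOf ℓ) (A⁻¹ a (l ∸ a)) i t) ⟩
  y (monOf ℓ · A⁻¹ a (l ∸ a)) i t                                      ∎
  where open ≡-Reasoning
        lemma : ∀ M b x → M - b + (x + b) ≡ M + x
        lemma = solve-∀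

monOf-f-new : ∀ {n} (ℓ : Kp n) a → a < n → monOf (addR a a ℓ) ≈M (monOf ℓ · A⁻¹ a 0)
monOf-f-new ℓ a a<n i t =
  trans (y-monOf-addR ℓ a a ℕₚ.≤-refl a<n i t)
        (trans (cong (λ z → y (monOf ℓ) i t + z) (y-block-diag a i t)) (sym (y-· (monOf ℓ) (A⁻¹ a 0) i t)))

monOf-e-move : ∀ {n} (ℓ : Kp n) a h → a < h → 0 < cnt ℓ a h → monOf (addR (suc a) h (subR a h ℓ)) ≈M (monOf ℓ · A a (h ∸ a))
monOf-e-move ℓ a h a<h pos i t with cnt-pos ℓ a h pos
... | _ , h<n = begin
  y (monOf (addR (suc a) h (subR a h ℓ))) i t                          ≡⟨ y-monOf-addR (subR a h ℓ) (suc a) h a<h h<n i t ⟩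
  y (monOf (subR a h ℓ)) i t + y (block (suc a) h) i t                 ≡⟨ cong (_+ y (block (suc a) h) i t) (y-monOf-subR ℓ a h pos i t) ⟩
  y (monOf ℓ) i t - y (block a h) i t + y (block (suc a) h) i t
     ≡⟨ cong (λ z → y (monOf ℓ) i t - z + y (block (suc a) h) i t)
             (trans (y-block-unfold a h a<h i t) (cong (_+ y (block (suc a) h) i t) (y-A⁻¹ a (h ∸ a) i t))) ⟩
  y (monOf ℓ) i t - (- y (A a (h ∸ a)) i t + y (block (suc a) h) i t) + y (block (suc a) h) i t
                                                                       ≡⟨ lemma (y (monOf ℓ) i t) (y (block (suc a) h) i t) (y (A a (h ∸ a)) i t) ⟩
  y (monOf ℓ) i t + y (A a (h ∸ a)) i t                                ≡⟨ sym (y-· (monOf ℓ) (A a (h ∸ a)) i t) ⟩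
  y (monOf ℓ · A a (h ∸ a)) i t                                        ∎
  where open ≡-Reasoning
        lemma : ∀ M b x → M - (- x + b) + b ≡ M + x
        lemma = solve-∀

monOf-e-delete : ∀ {n} (ℓ : Kp n) a → 0 < cnt ℓ a a → monOf (subR a a ℓ) ≈M (monOf ℓ · A a 0)
monOf-e-delete ℓ a pos i t = begin
  y (monOf (subR a a ℓ)) i t                 ≡⟨ y-monOf-subR ℓ a a pos i t ⟩
  y (monOf ℓ) i t - y (block a a) i t        ≡⟨ cong (λ z → y (monOf ℓ) i t - z) (trans (y-block-diag a i t) (y-A⁻¹ a 0 i t)) ⟩
  y (monOf ℓ) i t - - y (A a 0) i t          ≡⟨ cong (λ z → y (monOf ℓ) i t + z) (ℤₚ.neg-involutive (y (A a 0) i t)) ⟩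
  y (monOf ℓ) i t + y (A a 0) i t            ≡⟨ sym (y-· (monOf ℓ) (A a 0) i t) ⟩
  y (monOf ℓ · A a 0) i t                    ∎
  where open ≡-Reasoning

-- μ strictly decreases under every e_i, which bounds the number of e_i needed to reach the highest weight.
μ : ∀ {n} → Kp n → ℤ
μ {n} ℓ = ⟪ ℓ ∣ (λ j _ → + (n ∸ j)) ⟫

μ-nonneg : ∀ {n} (ℓ : Kp n) → + 0 ℤ.≤ μ ℓ
μ-nonneg {n} ℓ = Σᴸ-nonneg (allPairs n) (summand ℓ (λ j _ → + (n ∸ j)))
  (λ (j , k) → subst (+ 0 ℤ.≤_) (ℤₚ.pos-* (cnt ℓ j k) (n ∸ j)) (ℤ.+≤+ z≤n))

eM-ε≡0 : ∀ {n} (M : Mon n) i → εM M i ≡ + 0 → eM i M ≡ nothing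
eM-ε≡0 M i e = cong (λ x → if does (+ 0 ℤₚ.<? x) then just (M · A (toℕ i) (kE M i)) else nothing) e

eM-ε>0 : ∀ {n} (M : Mon n) i k → εM M i ≡ + suc k → eM i M ≡ just (M · A (toℕ i) (kE M i))
eM-ε>0 M i k e = cong (λ x → if does (+ 0 ℤₚ.<? x) then just (M · A (toℕ i) (kE M i)) else nothing) e

lowered : ∀ {n} → Kp n → (r h : ℕ) → Dec (r < h) → Kp n
lowered ℓ r h d = if does d then addR (suc r) h (subR r h ℓ) else subR r h ℓ

eK-by-head : ∀ {n} → Fin n → Kp n → List ℕ → Maybe (Kp n)
eK-by-head i ℓ []      = nothing
eK-by-head i ℓ (h ∷ _) = just (lowered ℓ (toℕ i) h (toℕ i <? h))

eK≡ : ∀ {n} (i : Fin n) ℓ → eK i ℓ ≡ eK-by-head i ℓ (proj₁ (reduced i ℓ))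
eK≡ i ℓ with proj₁ (reduced i ℓ)
... | []    = refl
... | _ ∷ _ = refl

fK-by-last : ∀ {n} → Fin n → Kp n → Maybe ℕ → Kp n
fK-by-last i ℓ nothing  = addR (toℕ i) (toℕ i) ℓ
fK-by-last i ℓ (just m) = addR (toℕ i) m (subR (suc (toℕ i)) m ℓ)

fK≡ : ∀ {n} (i : Fin n) ℓ → fK i ℓ ≡ fK-by-last i ℓ (last (proj₂ (reduced i ℓ)))
fK≡ i ℓ with last (proj₂ (reduced i ℓ))
... | nothing = refl
... | just _  = refl

-- The partial sums of row i of monOf ℓ are W + R (r + k), so their maxima are read off the reduced string.
module AtRow {n : ℕ} (ℓ : Kp n) (i : Fin n) where
  r : ℕ
  r = toℕ i

  open Profile ℓ r
  open Argmax (monOf ℓ i)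

  xs : List ℤ
  xs = monOf ℓ i

  W : ℤ
  W = psum xs 0 - R r

  psum-via-R : ∀ k → psum xs k ≡ W + R (r ℕ.+ k)
  psum-via-R zero    = trans (lemma (psum xs 0) (R r)) (cong (λ z → W + R z) (sym (ℕₚ.+-identityʳ r)))
    where lemma : ∀ a b → a ≡ a - b + b
          lemma = solve-∀
  psum-via-R (suc k) = begin
    psum xs k + y (monOf ℓ) i (suc k)
      ≡⟨ cong₂ _+_ (trans (psum-via-R k) (cong (λ z → W + z) (R-step (r ℕ.+ k)))) (y-monOf-suc ℓ i k) ⟩
    W + (+ closers (r ℕ.+ k) - + openers (suc (r ℕ.+ k)) + R (suc (r ℕ.+ k))) + (+ openers (suc r ℕ.+ k) - + closers (r ℕ.+ k))
      ≡⟨ lemma W (+ closers (r ℕ.+ k)) (+ openers (suc (r ℕ.+ k))) (R (suc (r ℕ.+ k))) ⟩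
    W + R (suc (r ℕ.+ k))
      ≡⟨ cong (λ z → W + R z) (sym (ℕₚ.+-suc r k)) ⟩
    W + R (r ℕ.+ suc k) ∎
    where open ≡-Reasoning
          lemma : ∀ W c o R′ → W + (c - o + R′) + (o - c) ≡ W + R′
          lemma = solve-∀

  total≡W : total xs ≡ W
  total≡W = begin
    total xs                ≡⟨ sym (psum-beyond xs K (ℕₚ.m≤n⇒m≤1+n (ℕₚ.m≤m+n _ n))) ⟩
    psum xs K               ≡⟨ psum-via-R K ⟩
    W + R (r ℕ.+ K)         ≡⟨ cong (λ z → W + z) (R-beyond (r ℕ.+ K) (ℕₚ.≤-trans (ℕₚ.m≤n+m n (length xs)) (ℕₚ.m≤n+m _ r))) ⟩
    W + + 0                 ≡⟨ ℤₚ.+-identityʳ W ⟩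
    W                       ∎
    where open ≡-Reasoning
          K = length xs ℕ.+ n

  S : Scanned r (proj₁ (reduced i ℓ)) (proj₂ (reduced i ℓ))
  S = scanned-string (Finₚ.toℕ<n i)
  open Scanned S

  L : ℕ
  L = εK ℓ i

  φL≡ : φL xs ≡ W + + L
  φL≡ = φL-unique xs (W + + L)
    (λ k → subst (ℤ._≤ W + + L) (sym (psum-via-R k)) (ℤₚ.+-monoʳ-≤ W (bounded (r ℕ.+ k) (ℕₚ.m≤m+n r k))))
    (let m* , r≤m* , Rm* = attained in
      m* ∸ r , trans (psum-via-R (m* ∸ r)) (cong (λ z → W + z) (trans (cong R (ℕₚ.m+[n∸m]≡n r≤m*)) Rm*)))

  max-at : ∀ m → r ≤ m → R m ≡ + L → IsMax (m ∸ r)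
  max-at m r≤m Rm = trans (psum-via-R (m ∸ r)) (trans (cong (λ z → W + R z) (ℕₚ.m+[n∸m]≡n r≤m)) (trans (cong (λ z → W + z) Rm) (sym φL≡)))

  below-max : ∀ k → R (r ℕ.+ k) ℤ.< + L → psum xs k ℤ.< φL xs
  below-max k R< = subst₂ ℤ._<_ (sym (psum-via-R k)) (sym φL≡) (ℤₚ.+-monoʳ-< W R<)

  ε-monOf : εM (monOf ℓ) i ≡ + L
  ε-monOf = trans (cong₂ _-_ φL≡ total≡W) (lemma W (+ L))
    where lemma : ∀ a b → a + b - a ≡ b
          lemma = solve-∀

  φ-monOf : φM (monOf ℓ) i ≡ φK ℓ i
  φ-monOf = trans (lemma (φM (monOf ℓ) i) (wtM (monOf ℓ) i)) (cong₂ _+_ ε-monOf (wt-monOf ℓ i))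
    where lemma : ∀ a b → a ≡ a - b + b
          lemma = solve-∀

  kE-at-rightmost : ∀ h t → proj₁ (reduced i ℓ) ≡ h ∷ t → kE (monOf ℓ) i ≡ h ∸ r
  kE-at-rightmost h t eq with rightmost h t eq
  ... | r≤h , Rh , after , _ = kEL-unique (h ∸ r)
    (subst₂ ℤ._<_ (sym total≡W) (sym φL≡) (j≡i+1+d⇒i<j (length t) (cong (λ cs → W + + length cs) eq)))
    (max-at h r≤h Rh)
    (λ j h∸r<j → below-max j (after (r ℕ.+ j) (subst (ℕ._< r ℕ.+ j) (ℕₚ.m+[n∸m]≡n r≤h) (ℕₚ.+-monoʳ-< r h∸r<j))))

  kbar-at-leftmost : ∀ l → last (proj₂ (reduced i ℓ)) ≡ just l → kbar (monOf ℓ) i ≡ l ∸ r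
  kbar-at-leftmost l eq with leftmost l eq
  ... | r≤l , Rl , before , _ = kbarL-unique (l ∸ r) (max-at l r≤l Rl)
    (λ j j<l∸r → below-max j (before (r ℕ.+ j) (ℕₚ.m≤m+n r j) (subst (r ℕ.+ j <_) (ℕₚ.m+[n∸m]≡n r≤l) (ℕₚ.+-monoʳ-< r j<l∸r))))

  kbar-without-openers : last (proj₂ (reduced i ℓ)) ≡ nothing → kbar (monOf ℓ) i ≡ 0
  kbar-without-openers eq = kbarL-unique 0 (subst IsMax (ℕₚ.n∸n≡0 r) (max-at r ℕₚ.≤-refl Rr)) (λ j ())
    where
      empty : ∀ (os : List ℕ) → last os ≡ nothing → os ≡ []
      empty []       _ = refl
      empty (o ∷ os) e with last-∷ o os
      ... | _ , e′ with trans (sym e′) e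
      ...   | ()
      Rr : R r ≡ + L
      Rr = sym (trans balanced (trans (cong (λ os → R r - + openers r + + length os) (empty (proj₂ (reduced i ℓ)) eq))
                 (trans (ℤₚ.+-identityʳ _) (trans (cong (λ o → R r - + o) openers-r) (ℤₚ.+-identityʳ (R r))))))

  e-monOf : MaybeRel _≈M_ (mapMaybe monOf (eK i ℓ)) (eM i (monOf ℓ))
  e-monOf = subst (λ e → MaybeRel _≈M_ (mapMaybe monOf e) (eM i (monOf ℓ))) (sym (eK≡ i ℓ)) (byHead (proj₁ (reduced i ℓ)) refl)
    where
      ε≡ : ∀ {cs} → proj₁ (reduced i ℓ) ≡ cs → εM (monOf ℓ) i ≡ + length cs
      ε≡ eq = trans ε-monOf (cong (λ cs → + length cs) eq)
      byHead : ∀ cs → proj₁ (reduced i ℓ) ≡ cs → MaybeRel _≈M_ (mapMaybe monOf (eK-by-head i ℓ cs)) (eM i (monOf ℓ))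
      byHead []      eq = subst (MaybeRel _≈M_ nothing) (sym (eM-ε≡0 (monOf ℓ) i (ε≡ eq))) nothing
      byHead (h ∷ t) eq with rightmost h t eq
      ... | r≤h , _ , _ , pos =
        subst (MaybeRel _≈M_ (just (monOf (lowered ℓ r h (r <? h))))) (sym (eM-ε>0 (monOf ℓ) i (length t) (ε≡ eq)))
              (just λ i′ t′ → trans (moved (r <? h) i′ t′) (cong (λ k → y (monOf ℓ · A r k) i′ t′) (sym (kE-at-rightmost h t eq))))
        where
          moved : (d : Dec (r < h)) → monOf (lowered ℓ r h d) ≈M (monOf ℓ · A r (h ∸ r))
          moved (yes r<h) = monOf-e-move ℓ r h r<h pos
          moved (no r≮h) with ℕₚ.m≤n⇒m<n∨m≡n r≤h
          ... | inj₁ r<h  = ⊥-elim (r≮h r<h)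
          ... | inj₂ refl = λ i′ t′ → trans (monOf-e-delete ℓ r pos i′ t′) (cong (λ k → y (monOf ℓ · A r k) i′ t′) (sym (ℕₚ.n∸n≡0 r)))

  f-monOf : monOf (fK i ℓ) ≈M fM i (monOf ℓ)
  f-monOf = subst (λ f → monOf f ≈M fM i (monOf ℓ)) (sym (fK≡ i ℓ)) (byLast (last (proj₂ (reduced i ℓ))) refl)
    where
      atKbar : ∀ {ℓ′ k} → monOf ℓ′ ≈M (monOf ℓ · A⁻¹ r k) → kbar (monOf ℓ) i ≡ k → monOf ℓ′ ≈M fM i (monOf ℓ)
      atKbar moved e i′ t′ = trans (moved i′ t′) (cong (λ k → y (monOf ℓ · A⁻¹ r k) i′ t′) (sym e))
      byLast : ∀ mb → last (proj₂ (reduced i ℓ)) ≡ mb → monOf (fK-by-last i ℓ mb) ≈M fM i (monOf ℓ)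
      byLast nothing  eq = atKbar (monOf-f-new ℓ r (Finₚ.toℕ<n i)) (kbar-without-openers eq)
      byLast (just l) eq with leftmost l eq
      ... | _ , _ , _ , pos = atKbar (monOf-f-move ℓ r l (proj₁ (cnt-pos ℓ (suc r) l pos)) pos) (kbar-at-leftmost l eq)

  μ-lowered : ∀ h → r ≤ h → 0 < cnt ℓ r h → (d : Dec (r < h)) → μ (lowered ℓ r h d) ℤ.< μ ℓ
  μ-lowered h r≤h pos d with cnt-pos ℓ r h pos
  ... | _ , h<n = byCases d
    where
      w : ℕ → ℕ → ℤ
      w j _ = + (n ∸ j)
      n∸r : + (n ∸ r) ≡ + 1 + + (n ∸ suc r)
      n∸r = cong +_ (∸-suc n r (ℕₚ.≤-<-trans r≤h h<n))
      byCases : (d : Dec (r < h)) → μ (lowered ℓ r h d) ℤ.< μ ℓ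
      byCases (yes r<h) = i≡j-1+d⇒i<j 0 (begin
        μ (addR (suc r) h (subR r h ℓ))           ≡⟨ ⟪⟫-addR (subR r h ℓ) (suc r) h w r<h h<n ⟩
        μ (subR r h ℓ) + + (n ∸ suc r)            ≡⟨ cong (_+ + (n ∸ suc r)) (⟪⟫-subR ℓ r h w pos) ⟩
        μ ℓ - + (n ∸ r) + + (n ∸ suc r)           ≡⟨ cong (λ z → μ ℓ - z + + (n ∸ suc r)) n∸r ⟩
        μ ℓ - (+ 1 + + (n ∸ suc r)) + + (n ∸ suc r) ≡⟨ lemma (μ ℓ) (+ (n ∸ suc r)) ⟩
        μ ℓ - + 1                                 ∎)
        where open ≡-Reasoning
              lemma : ∀ a b → a - (+ 1 + b) + b ≡ a - + 1
              lemma = solve-∀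
      byCases (no _) = i≡j-1+d⇒i<j (n ∸ suc r)
        (trans (⟪⟫-subR ℓ r h w pos) (cong (λ z → μ ℓ - z) (trans n∸r (sym (ℤₚ.pos-+ 1 (n ∸ suc r))))))

  e-lowers-μ : 0 < L → ∃ λ ℓ′ → eK i ℓ ≡ just ℓ′ × μ ℓ′ ℤ.< μ ℓ
  e-lowers-μ L>0 = byHead (proj₁ (reduced i ℓ)) refl L>0
    where
      byHead : ∀ cs → proj₁ (reduced i ℓ) ≡ cs → 0 < length cs → ∃ λ ℓ′ → eK i ℓ ≡ just ℓ′ × μ ℓ′ ℤ.< μ ℓ
      byHead (h ∷ t) eq _ with rightmost h t eq
      ... | r≤h , _ , _ , pos = lowered ℓ r h (r <? h) , trans (eK≡ i ℓ) (cong (eK-by-head i ℓ) eq) , μ-lowered h r≤h pos (r <? h)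

cnt-zero : ∀ {n} j k → cnt {n} (λ _ → 0) j k ≡ 0
cnt-zero {n} j k with j ≤? k | k <? n
... | yes _ | yes _ = refl
... | no _  | _     = refl
... | yes _ | no _  = refl

MaybeRel-just : ∀ {n} (a : Maybe (Kp n)) (b c : Maybe (Mon n)) {M} →
  MaybeRel _≈M_ (mapMaybe monOf a) b → MaybeRel _≈M_ b c → c ≡ just M → ∃ λ ℓ → monOf ℓ ≈M M
MaybeRel-just (just ℓ) (just _) (just _) (just e₁) (just e₂) refl = ℓ , λ i t → trans (e₁ i t) (e₂ i t)

𝓜∞-in-image : ∀ {n} (M : Mon n) → InM∞ M → ∃ λ ℓ → monOf ℓ ≈M M
𝓜∞-in-image M one = (λ _ → 0) , monOf-zero (λ _ → 0) (λ j k _ _ → cnt-zero j k)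
𝓜∞-in-image .(fM i M) (byF i M h) with 𝓜∞-in-image M h
... | ℓ , e = fK i ℓ , λ i′ t → trans (AtRow.f-monOf ℓ i i′ t) (Respect.fM-resp {M = monOf ℓ} {N = M} e i i′ t)
𝓜∞-in-image M′ (byE i M .M′ h eq) with 𝓜∞-in-image M h
... | ℓ , e = MaybeRel-just (eK i ℓ) (eM i (monOf ℓ)) (eM i M) (AtRow.e-monOf ℓ i) (Respect.eM-resp {M = monOf ℓ} {N = M} e i) eq
𝓜∞-in-image N (resp M .N e′ h) with 𝓜∞-in-image M h
... | ℓ , e = ℓ , λ i t → trans (e i t) (e′ i t)

-- Row r holds at most ε_r more roots than row r + 1, and the row beyond the last is empty.
module HighestWeight {n : ℕ} (ℓ : Kp n) where
  rowTotal : ℕ → ℤ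
  rowTotal a = tailSum (λ m → + cnt ℓ a m) (n ∸ a) a

  rowTotal≤ : ∀ (i : Fin n) → rowTotal (toℕ i) ℤ.≤ rowTotal (suc (toℕ i)) + + εK ℓ i
  rowTotal≤ i = subst (ℤ._≤ rowTotal (suc r) + + εK ℓ i) (lemma (rowTotal r) (rowTotal (suc r)))
    (ℤₚ.+-monoʳ-≤ (rowTotal (suc r)) (subst (ℤ._≤ + εK ℓ i) R≡ (Scanned.bounded (AtRow.S ℓ i) r ℕₚ.≤-refl)))
    where
      open Profile ℓ (toℕ i)
      r = toℕ i
      K = n ∸ suc r
      lemma : ∀ a b → b + (a - b) ≡ a
      lemma = solve-∀
      R≡ : R r ≡ rowTotal r - rowTotal (suc r)
      R≡ = trans (tailSum-- (λ m → + closers m) (λ m → + openers (suc m)) (n ∸ r) r)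
        (cong (λ z → rowTotal r - z) (begin
          tailSum (λ m → + openers (suc m)) (n ∸ r) r     ≡⟨ tailSum-shift (λ m → + openers m) (n ∸ r) r ⟩
          tailSum (λ m → + openers m) (n ∸ r) (suc r)     ≡⟨ cong (λ F → tailSum (λ m → + openers m) F (suc r)) (∸-suc n r (Finₚ.toℕ<n i)) ⟩
          tailSum (λ m → + openers m) (suc K) (suc r)     ≡⟨ tailSum-snoc (λ m → + openers m) K (suc r) ⟩
          rowTotal (suc r) + + openers (suc r ℕ.+ K)      ≡⟨ cong (λ m → rowTotal (suc r) + + openers m) (ℕₚ.m+[n∸m]≡n (Finₚ.toℕ<n i)) ⟩
          rowTotal (suc r) + + openers n                  ≡⟨ cong (λ o → rowTotal (suc r) + + o) (openers-beyond n ℕₚ.≤-refl) ⟩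
          rowTotal (suc r) + + 0                          ≡⟨ ℤₚ.+-identityʳ _ ⟩
          rowTotal (suc r)                                ∎))
        where open ≡-Reasoning

  rowTotal≤0 : (∀ i → εK ℓ i ≡ 0) → ∀ d a → n ≤ a ℕ.+ d → rowTotal a ℤ.≤ + 0
  rowTotal≤0 ε≡0 d a n≤a+d = byCases d a n≤a+d (a <? n)
    where
      byCases : ∀ d a → n ≤ a ℕ.+ d → Dec (a < n) → rowTotal a ℤ.≤ + 0
      byCases d a _ (no a≮n) rewrite ℕₚ.m≤n⇒m∸n≡0 (ℕₚ.≮⇒≥ a≮n) = ℤₚ.≤-refl
      byCases zero a n≤a (yes a<n) = ⊥-elim (ℕₚ.<⇒≱ a<n (subst (n ≤_) (ℕₚ.+-identityʳ a) n≤a))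
      byCases (suc d) a n≤a+d (yes a<n) = ℤₚ.≤-trans
        (subst (λ b → rowTotal b ℤ.≤ rowTotal (suc b) + + εK ℓ (fromℕ< a<n)) (Finₚ.toℕ-fromℕ< a<n) (rowTotal≤ (fromℕ< a<n)))
        (subst (ℤ._≤ + 0) (sym (trans (cong (λ e → rowTotal (suc a) + + e) (ε≡0 (fromℕ< a<n))) (ℤₚ.+-identityʳ _)))
               (byCases d (suc a) (subst (n ≤_) (ℕₚ.+-suc a d) n≤a+d) (suc a <? n)))

  highest-weight-is-zero : (∀ i → εK ℓ i ≡ 0) → ∀ j k → j ≤ k → k < n → cnt ℓ j k ≡ 0
  highest-weight-is-zero ε≡0 j k j≤k k<n = ℕₚ.n≤0⇒n≡0 (ℤₚ.drop‿+≤+ (ℤₚ.≤-trans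
    (subst (ℤ._≤ rowTotal j) (cong (λ m → + cnt ℓ j m) (ℕₚ.m+[n∸m]≡n j≤k))
           (term≤tailSum (λ m → + cnt ℓ j m) (λ _ → ℤ.+≤+ z≤n) (n ∸ j) j (k ∸ j) (ℕₚ.∸-monoˡ-< k<n j≤k)))
    (rowTotal≤0 ε≡0 n j (ℕₚ.m≤n+m n j))))

e-then-f : ∀ {n} (ℓ : Kp n) i {ℓ′} → 0 < εK ℓ i → eK i ℓ ≡ just ℓ′ → fM i (monOf ℓ′) ≈M monOf ℓ
e-then-f ℓ i {ℓ′} ε>0 eK≡ =
  f-after-e (monOf ℓ) (monOf ℓ′) i ε>0′ (unjust (subst₂ (MaybeRel _≈M_) (cong (mapMaybe monOf) eK≡) eM≡ (AtRow.e-monOf ℓ i)))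
  where
    ε>0′ : + 0 ℤ.< εM (monOf ℓ) i
    ε>0′ = subst (+ 0 ℤ.<_) (sym (AtRow.ε-monOf ℓ i)) (ℤ.+<+ ε>0)
    eM≡ : eM i (monOf ℓ) ≡ just (monOf ℓ · A (toℕ i) (kE (monOf ℓ) i))
    eM≡ = eM-ε>0 (monOf ℓ) i (ℕ.pred (εK ℓ i)) (trans (AtRow.ε-monOf ℓ i) (cong +_ (sym (suc-pred ε>0))))
      where suc-pred : ∀ {m} → 0 < m → suc (ℕ.pred m) ≡ m
            suc-pred {suc m} _ = refl
    unjust : ∀ {M N : Mon _} → MaybeRel _≈M_ (just M) (just N) → M ≈M N
    unjust (just e) = e

reach : ∀ {n} f (ℓ : Kp n) → μ ℓ ℤ.≤ + f → InM∞ (monOf ℓ)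
reach {n} f ℓ μ≤f with Finₚ.any? (λ i → 0 <? εK ℓ i)
... | no none = resp 𝟏 (monOf ℓ) (λ i t → sym (monOf-zero ℓ (HighestWeight.highest-weight-is-zero ℓ ε≡0) i t)) one
  where ε≡0 : ∀ i → εK ℓ i ≡ 0
        ε≡0 i = ℕₚ.n≤0⇒n≡0 (ℕₚ.≮⇒≥ (λ ε>0 → none (i , ε>0)))
... | yes (i , ε>0) with AtRow.e-lowers-μ ℓ i ε>0
...   | ℓ′ , eK≡ , μ< = resp (fM i (monOf ℓ′)) (monOf ℓ) (e-then-f ℓ i ε>0 eK≡) (byF i (monOf ℓ′) (reach′ f μ≤f))
  where
    reach′ : ∀ f → μ ℓ ℤ.≤ + f → InM∞ (monOf ℓ′)
    reach′ zero    μ≤0  = ⊥-elim (ℤₚ.<⇒≱ (ℤₚ.≤-<-trans (μ-nonneg ℓ′) μ<) μ≤0)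
    reach′ (suc f) μ≤1+f = reach f ℓ′ (ℤₚ.i<j⇒i≤pred[j] (ℤₚ.<-≤-trans μ< μ≤1+f))

monOf-in-𝓜∞ : ∀ {n} (ℓ : Kp n) → InM∞ (monOf ℓ)
monOf-in-𝓜∞ ℓ = reach ℤ.∣ μ ℓ ∣ ℓ (ℤₚ.≤-reflexive (sym (ℤₚ.0≤i⇒+∣i∣≡i (μ-nonneg ℓ))))

theorem6p5 : (n : ℕ) → 1 ≤ n →
    -- every M ∈ 𝓜(∞)_c is  ∏_{j≤k} (∏_{p=j}^{k} A_(p,k-p)^(-1))^{ℓ_{j,k}}  for some ℓ …
    ((M : Mon n) → InM∞ M → Σ (Kp n) (λ ℓ → monOf ℓ ≈M M))
    -- … and such ℓ is unique
    × ((ℓ ℓ' : Kp n) → monOf ℓ ≈M monOf ℓ' → ℓ ≈K ℓ')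
    -- the map M ↦ Σ ℓ_{j,k} (α_{j,k}) is onto Kp(∞) (every such monomial lies in 𝓜(∞)_c)
    × ((ℓ : Kp n) → InM∞ (monOf ℓ))
    -- and it is a morphism of crystals: compatible with wt, ε_i, φ_i, f_i, e_i
    × ((ℓ : Kp n) (i : Fin n) → wtM (monOf ℓ) i ≡ wtK ℓ i)
    × ((ℓ : Kp n) (i : Fin n) → εM (monOf ℓ) i ≡ + εK ℓ i)
    × ((ℓ : Kp n) (i : Fin n) → φM (monOf ℓ) i ≡ φK ℓ i)
    × ((ℓ : Kp n) (i : Fin n) → monOf (fK i ℓ) ≈M fM i (monOf ℓ))
    × ((ℓ : Kp n) (i : Fin n) → MaybeRel _≈M_ (mapMaybe monOf (eK i ℓ)) (eM i (monOf ℓ)))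
theorem6p5 n _ =
  𝓜∞-in-image , monOf-injective , monOf-in-𝓜∞ , wt-monOf ,
  AtRow.ε-monOf , AtRow.φ-monOf , AtRow.f-monOf , AtRow.e-monOf
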